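{- Let $a$ be a positive integer and $k\geq 0$ an integer. Define the linear operator on the ring of symmetric functions $$CP_{a^k} = \sum_{\lambda:\ l(\lambda) \leq k} p_a^{k-l(\lambda)} \prod_{i=1}^{l(\lambda)} \left( p_{\lambda_i+a} - p_{\lambda_i} p_a \right) \frac{p_\lambda^\perp}{z_\lambda},$$ where the sum is over all partitions $\lambda$ with at most $k$ parts (in particular $CP_{a^0}=1$). Then for every partition $\mu$ with $l(\mu)<k$ we have $CP_{a^k}\, p_\mu = p_{\mu+a^k}$.
   Context: Work in the ring $\Lambda$ of symmetric functions over $\mathbb{Q}$ with power sums $p_\lambda=p_{\lambda_1}p_{\lambda_2}\cdots$ and the Hall inner product $\langle p_\lambda,p_\mu\rangle = z_\lambda\delta_{\lambda\mu}$, where $z_\lambda=\prod_{i\ge1} i^{n_i(\lambda)}n_i(\lambda)!$ and $n_i(\lambda)$ is the number of parts of $\lambda$ equal to $i$. For a symmetric function $f$, $f^\perp$ denotes the adjoint of multiplication by $f$: $\langle f^\perp P,Q\rangle=\langle P,fQ\rangle$. $l(\lambda)$ is the number of nonzero parts of $\lambda$. For a partition $\mu$ with $l(\mu)\le k$, $\mu+a^k$ denotes the partition $(\mu_1+a,\mu_2+a,\ldots,\mu_k+a)$, where $\mu_i=0$ for $i>l(\mu)$; so $p_{\mu+a^k}=\prod_{i=1}^k p_{\mu_i+a}$. -}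

module Defs where

open import Data.Nat as ℕ using (ℕ; zero; suc; _∸_; _≤_; _<_; _!; _^_)
open import Data.Integer using (+_)
open import Data.Rational as ℚ using (ℚ)
open import Data.List using (List; []; _∷_; _++_; map; foldr; concatMap; filter; length; replicate; upTo; applyUpTo)
open import Data.List.Properties using (≡-dec)
open import Data.Nat.ListAction using (sum)
open import Data.List.Relation.Unary.All using (All)
open import Data.List.Relation.Unary.Linked using (Linked)
open import Data.Product using (_×_; _,_; proj₂)
open import Relation.Nullary using (yes; no)
open import Relation.Binary.PropositionalEquality using (_≡_)

Partition : Set
Partition = List ℕ

IsPartition : List ℕ → Set
IsPartition μ = All (0 <_) μ × Linked ℕ._≥_ μ

insert : ℕ → List ℕ → List ℕ
insert x [] = x ∷ []
insert x (y ∷ ys) with y ℕ.≤? x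
... | yes _ = x ∷ y ∷ ys
... | no _ = y ∷ insert x ys

sortP : List ℕ → Partition
sortP = foldr (λ { zero ν → ν ; (suc x) ν → insert (suc x) ν }) []

-- multiset union of partitions (p_λ p_ν = p_{λ ∪ ν})
union : Partition → Partition → Partition
union la ν = foldr insert ν la

mult : ℕ → Partition → ℕ
mult i [] = 0
mult i (x ∷ xs) with i ℕ.≟ x
... | yes _ = suc (mult i xs)
... | no _ = mult i xs

-- z_λ = ∏_{i ≥ 1} i^{n_i} n_i!  (parts are ≤ |λ|, so i ranges over 1..|λ|)
z : Partition → ℕ
z la = foldr ℕ._*_ 1 (applyUpTo (λ j → (suc j ^ mult (suc j) la) ℕ.* ((mult (suc j) la) !)) (sum la))

-- 1/n in ℚ (for n ≥ 1; z_λ is always ≥ 1)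
recip : ℕ → ℚ
recip zero = ℚ.0ℚ
recip (suc n) = + 1 ℚ./ suc n

-- Elements of Λ over ℚ as finite formal ℚ-linear combinations of power sums p_λ.
Sym : Set
Sym = List (ℚ × Partition)

coeff : Sym → Partition → ℚ
coeff [] la = ℚ.0ℚ
coeff ((c , ν) ∷ f) la with ≡-dec ℕ._≟_ ν la
... | yes _ = c ℚ.+ coeff f la
... | no _ = coeff f la

infix 4 _≈_
_≈_ : Sym → Sym → Set
f ≈ g = ∀ la → coeff f la ≡ coeff g la

p : List ℕ → Sym
p la = (ℚ.1ℚ , sortP la) ∷ []

zeroS : Sym
zeroS = []

oneS : Sym
oneS = p []

infixl 6 _⊕_ _⊖_
infixl 7 _⊗_ _⊙_

_⊕_ : Sym → Sym → Sym
f ⊕ g = f ++ g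

_⊙_ : ℚ → Sym → Sym
c ⊙ f = map (λ { (d , ν) → (c ℚ.* d , ν) }) f

_⊖_ : Sym → Sym → Sym
f ⊖ g = f ⊕ (ℚ.- ℚ.1ℚ) ⊙ g

_⊗_ : Sym → Sym → Sym
f ⊗ g = concatMap (λ { (c , la) → map (λ { (d , ν) → (c ℚ.* d , union la ν) }) g }) f

prodS : List Sym → Sym
prodS = foldr _⊗_ oneS

powS : Sym → ℕ → Sym
powS f zero = oneS
powS f (suc n) = f ⊗ powS f n

sumS : List Sym → Sym
sumS = foldr _⊕_ zeroS

pairIP : ℚ × Partition → ℚ × Partition → ℚ
pairIP (c , la) (d , ν) with ≡-dec ℕ._≟_ la ν
... | yes _ = c ℚ.* d ℚ.* (+ z la ℚ./ 1)
... | no _ = ℚ.0ℚ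

⟪_,_⟫ : Sym → Sym → ℚ
⟪ f , g ⟫ = foldr ℚ._+_ ℚ.0ℚ (concatMap (λ t → map (pairIP t) g) f)

deg : Sym → ℕ
deg = foldr (λ t m → sum (proj₂ t) ℕ.⊔ m) 0

-- partitions of n with all parts ≤ m (fuel-driven enumeration)
partsF : ℕ → ℕ → ℕ → List Partition
partsF fuel zero m = [] ∷ []
partsF zero (suc n) m = []
partsF (suc fuel) (suc n) m =
  concatMap (λ j → map (suc j ∷_) (partsF fuel (suc n ∸ suc j) (suc j)))
            (filter (λ j → suc j ℕ.≤? m) (upTo (suc n)))

partitions : ℕ → List Partition
partitions n = partsF n n n

partitionsUpTo : ℕ → List Partition
partitionsUpTo d = concatMap partitions (upTo (suc d))

-- f^⊥ as the adjoint of multiplication by f w.r.t. the Hall inner product: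
-- f^⊥ P = Σ_ν ⟨f^⊥ P, p_ν⟩/z_ν p_ν = Σ_ν ⟨P, f p_ν⟩/z_ν p_ν.
-- Only ν with |ν| ≤ deg P can contribute (f p_ν has degree ≥ |ν|).
perp : Sym → Sym → Sym
perp f P = map (λ ν → (⟪ P , f ⊗ p ν ⟫ ℚ.* recip (z ν) , ν)) (partitionsUpTo (deg P))

-- CP_{a^k} P = Σ_{l(λ) ≤ k} p_a^{k-l(λ)} ∏_i (p_{λ_i+a} - p_{λ_i} p_a) (p_λ^⊥ P)/z_λ.
-- Only λ with |λ| ≤ deg P can contribute (p_λ^⊥ P = 0 otherwise).
CP : ℕ → ℕ → Sym → Sym
CP a k P = sumS (map term (filter (λ la → length la ℕ.≤? k) (partitionsUpTo (deg P))))
  where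
  term : Partition → Sym
  term la = powS (p (a ∷ [])) (k ∸ length la)
            ⊗ prodS (map (λ i → p (i ℕ.+ a ∷ []) ⊖ p (i ∷ []) ⊗ p (a ∷ [])) la)
            ⊗ (recip (z la) ⊙ perp (p la) P)

plusRect : ℕ → ℕ → Partition → Partition
plusRect a k μ = map (ℕ._+ a) (μ ++ replicate (k ∸ length μ) 0)

-- Only λ ⊆ μ survive in p_λ^⊥ p_μ, so CP_{a^k} p_μ is a sum over the decompositions of the
-- multiset μ as λ ∪ ν of (z_μ / (z_λ z_ν)) p_a^{k-l(λ)} ∏_{i∈λ} (p_{i+a} - p_i p_a) p_ν.  The weight
-- z_μ / (z_λ z_ν) = ∏_i binom(n_i(μ), n_i(λ)) counts the ways of realising such a decomposition by
-- positions, so the sum runs over all 2^{l(μ)} ways of sending each part of μ to λ or to ν; this is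
-- proved by peeling off the largest part, where the weights obey Pascal's rule.  The sum over
-- positions factorises as p_a^{k-l(μ)} ∏_{i∈μ} ((p_{i+a} - p_i p_a) + p_a p_i) = p_{μ+a^k}.
-- Elements of Λ are compared through their values on test functions of the multiset of parts,
-- under which products of power sums commute and associate.

module Submission where

open import Defs
open import Data.Nat using (ℕ; _<_)
open import Data.List using (length)

module Sums where

  open import Data.Rational using (ℚ; 0ℚ; _+_; _*_)
  import Data.Rational.Properties as ℚP
  open import Data.List using (List; []; _∷_; _++_; map; concatMap; filter)
  open import Data.List.Relation.Unary.All using (All; []; _∷_)
  open import Relation.Nullary using (Dec; yes; no)
  open import Relation.Unary using (Decidable)
  open import Relation.Binary.PropositionalEquality
  open import Relation.Nullary.Decidable using (dec⇒maybe)
  open import Tactic.RingSolver using (solve-∀)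
  open import Tactic.RingSolver.Core.AlmostCommutativeRing using (AlmostCommutativeRing; fromCommutativeRing)

  ℚ-ring : AlmostCommutativeRing _ _
  ℚ-ring = fromCommutativeRing ℚP.+-*-commutativeRing (λ x → dec⇒maybe (0ℚ ℚP.≟ x))

  when : ∀ {q} {Q : Set q} → Dec Q → ℚ → ℚ
  when (yes _) v = v
  when (no _) v = 0ℚ

  ∑ : ∀ {A : Set} → List A → (A → ℚ) → ℚ
  ∑ [] f = 0ℚ
  ∑ (x ∷ xs) f = f x + ∑ xs f

  module _ {A : Set} where

    ∑-cong : (L : List A) {f g : A → ℚ} → (∀ x → f x ≡ g x) → ∑ L f ≡ ∑ L g
    ∑-cong [] e = refl
    ∑-cong (x ∷ L) e = cong₂ _+_ (e x) (∑-cong L e)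

    ∑-congᴬ : {L : List A} {f g : A → ℚ} → All (λ x → f x ≡ g x) L → ∑ L f ≡ ∑ L g
    ∑-congᴬ [] = refl
    ∑-congᴬ (e ∷ es) = cong₂ _+_ e (∑-congᴬ es)

    ∑-zeroᴬ : {L : List A} (f : A → ℚ) → All (λ x → f x ≡ 0ℚ) L → ∑ L f ≡ 0ℚ
    ∑-zeroᴬ f [] = refl
    ∑-zeroᴬ f (e ∷ es) rewrite e | ∑-zeroᴬ f es = refl

    ∑-zero : (L : List A) → ∑ L (λ _ → 0ℚ) ≡ 0ℚ
    ∑-zero [] = refl
    ∑-zero (x ∷ L) = trans (ℚP.+-identityˡ _) (∑-zero L)

    ∑-+ : (L : List A) (f g : A → ℚ) → ∑ L (λ x → f x + g x) ≡ ∑ L f + ∑ L g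
    ∑-+ [] f g = refl
    ∑-+ (x ∷ L) f g rewrite ∑-+ L f g = interchange (f x) (g x) (∑ L f) (∑ L g)
      where
      interchange : ∀ a b c d → (a + b) + (c + d) ≡ (a + c) + (b + d)
      interchange = solve-∀ ℚ-ring

    ∑-*ˡ : (L : List A) (c : ℚ) (f : A → ℚ) → ∑ L (λ x → c * f x) ≡ c * ∑ L f
    ∑-*ˡ [] c f = sym (ℚP.*-zeroʳ c)
    ∑-*ˡ (x ∷ L) c f rewrite ∑-*ˡ L c f = sym (ℚP.*-distribˡ-+ c (f x) (∑ L f))

    ∑-++ : (L L' : List A) (f : A → ℚ) → ∑ (L ++ L') f ≡ ∑ L f + ∑ L' f
    ∑-++ [] L' f = sym (ℚP.+-identityˡ _)
    ∑-++ (x ∷ L) L' f rewrite ∑-++ L L' f = sym (ℚP.+-assoc (f x) _ _)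

    ∑-filter : ∀ {p} {P : A → Set p} (P? : Decidable P) (L : List A) (f : A → ℚ) →
      ∑ (filter P? L) f ≡ ∑ L (λ x → when (P? x) (f x))
    ∑-filter P? [] f = refl
    ∑-filter P? (x ∷ L) f with P? x
    ... | yes _ = cong (f x +_) (∑-filter P? L f)
    ... | no _ = trans (∑-filter P? L f) (sym (ℚP.+-identityˡ _))

    ∑-when : ∀ {q} {Q : Set q} (d : Dec Q) (L : List A) (f : A → ℚ) →
      ∑ L (λ x → when d (f x)) ≡ when d (∑ L f)
    ∑-when (yes _) L f = refl
    ∑-when (no _) L f = ∑-zero L

  module _ {A B : Set} where

    ∑-map : (g : A → B) (L : List A) (f : B → ℚ) → ∑ (map g L) f ≡ ∑ L (λ x → f (g x))
    ∑-map g [] f = refl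
    ∑-map g (x ∷ L) f = cong (f (g x) +_) (∑-map g L f)

    ∑-concatMap : (g : A → List B) (L : List A) (f : B → ℚ) →
      ∑ (concatMap g L) f ≡ ∑ L (λ x → ∑ (g x) f)
    ∑-concatMap g [] f = refl
    ∑-concatMap g (x ∷ L) f = trans (∑-++ (g x) _ f) (cong (∑ (g x) f +_) (∑-concatMap g L f))

    ∑-comm : (L : List A) (L' : List B) (f : A → B → ℚ) →
      ∑ L (λ x → ∑ L' (λ y → f x y)) ≡ ∑ L' (λ y → ∑ L (λ x → f x y))
    ∑-comm [] L' f = sym (∑-zero L')
    ∑-comm (x ∷ L) L' f rewrite ∑-comm L L' f = sym (∑-+ L' (λ y → f x y) (λ y → ∑ L (λ x' → f x' y)))

module NatCast where

  open import Data.Nat as ℕ using (ℕ; zero; suc)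
  import Data.Nat.Properties as ℕP
  import Data.Integer as ℤ
  open import Data.Integer using (+_)
  import Data.Integer.Properties as ℤP
  open import Data.Rational as ℚ using (ℚ; 1ℚ; _*_; toℚᵘ)
  open import Data.Rational.Properties using (toℚᵘ-fromℚᵘ; toℚᵘ-injective; toℚᵘ-homo-*; toℚᵘ-homo-+; *-zeroˡ; *-zeroʳ)
  open import Data.Rational.Unnormalised as U using (mkℚᵘ; *≡*) renaming (_≃_ to _≃ᵘ_)
  import Data.Rational.Unnormalised.Properties as Uᴾ
  open import Relation.Binary.PropositionalEquality
  open import Defs using (recip)
  open Uᴾ.≃-Reasoning

  fromℕ : ℕ → ℚ
  fromℕ n = + n ℚ./ 1

  private
    toℚᵘ-fromℕ : ∀ n → toℚᵘ (fromℕ n) ≃ᵘ mkℚᵘ (+ n) 0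
    toℚᵘ-fromℕ n = toℚᵘ-fromℚᵘ (mkℚᵘ (+ n) 0)

    toℚᵘ-recip : ∀ n → toℚᵘ (recip (suc n)) ≃ᵘ mkℚᵘ (+ 1) n
    toℚᵘ-recip n = toℚᵘ-fromℚᵘ (mkℚᵘ (+ 1) n)

  fromℕ-* : ∀ a b → fromℕ (a ℕ.* b) ≡ fromℕ a * fromℕ b
  fromℕ-* a b = toℚᵘ-injective (begin
    toℚᵘ (fromℕ (a ℕ.* b))                        ≈⟨ toℚᵘ-fromℕ (a ℕ.* b) ⟩
    mkℚᵘ (+ (a ℕ.* b)) 0                          ≈⟨ Uᴾ.≃-reflexive (cong (λ i → mkℚᵘ i 0) (ℤP.pos-* a b)) ⟩
    U._*_ (mkℚᵘ (+ a) 0) (mkℚᵘ (+ b) 0)           ≈⟨ Uᴾ.≃-sym (Uᴾ.*-cong (toℚᵘ-fromℕ a) (toℚᵘ-fromℕ b)) ⟩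
    U._*_ (toℚᵘ (fromℕ a)) (toℚᵘ (fromℕ b))       ≈⟨ Uᴾ.≃-sym (toℚᵘ-homo-* (fromℕ a) (fromℕ b)) ⟩
    toℚᵘ (fromℕ a * fromℕ b)                      ∎)

  fromℕ-+ : ∀ a b → fromℕ (a ℕ.+ b) ≡ fromℕ a ℚ.+ fromℕ b
  fromℕ-+ a b = toℚᵘ-injective (begin
    toℚᵘ (fromℕ (a ℕ.+ b))                        ≈⟨ toℚᵘ-fromℕ (a ℕ.+ b) ⟩
    mkℚᵘ (+ (a ℕ.+ b)) 0                          ≈⟨ *≡* (cong (ℤ._* + 1) pos-+) ⟩
    U._+_ (mkℚᵘ (+ a) 0) (mkℚᵘ (+ b) 0)           ≈⟨ Uᴾ.≃-sym (Uᴾ.+-cong (toℚᵘ-fromℕ a) (toℚᵘ-fromℕ b)) ⟩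
    U._+_ (toℚᵘ (fromℕ a)) (toℚᵘ (fromℕ b))       ≈⟨ Uᴾ.≃-sym (toℚᵘ-homo-+ (fromℕ a) (fromℕ b)) ⟩
    toℚᵘ (fromℕ a ℚ.+ fromℕ b)                    ∎)
    where
    pos-+ : + (a ℕ.+ b) ≡ + a ℤ.* + 1 ℤ.+ + b ℤ.* + 1
    pos-+ = trans (ℤP.pos-+ a b) (sym (cong₂ ℤ._+_ (ℤP.*-identityʳ (+ a)) (ℤP.*-identityʳ (+ b))))

  recip-* : ∀ a b → recip (a ℕ.* b) ≡ recip a * recip b
  recip-* zero b = sym (*-zeroˡ (recip b))
  recip-* (suc a) zero rewrite ℕP.*-zeroʳ a = sym (*-zeroʳ (recip (suc a)))
  recip-* (suc a) (suc b) = toℚᵘ-injective (begin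
    toℚᵘ (recip (suc a ℕ.* suc b))                      ≈⟨ toℚᵘ-recip (b ℕ.+ a ℕ.* suc b) ⟩
    mkℚᵘ (+ 1) (b ℕ.+ a ℕ.* suc b)                      ≈⟨ *≡* refl ⟩
    U._*_ (mkℚᵘ (+ 1) a) (mkℚᵘ (+ 1) b)                 ≈⟨ Uᴾ.≃-sym (Uᴾ.*-cong (toℚᵘ-recip a) (toℚᵘ-recip b)) ⟩
    U._*_ (toℚᵘ (recip (suc a))) (toℚᵘ (recip (suc b))) ≈⟨ Uᴾ.≃-sym (toℚᵘ-homo-* (recip (suc a)) (recip (suc b))) ⟩
    toℚᵘ (recip (suc a) * recip (suc b))                ∎)

  recip-inverseˡ : ∀ n → recip (suc n) * fromℕ (suc n) ≡ 1ℚ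
  recip-inverseˡ n = toℚᵘ-injective (begin
    toℚᵘ (recip (suc n) * fromℕ (suc n))                ≈⟨ toℚᵘ-homo-* (recip (suc n)) (fromℕ (suc n)) ⟩
    U._*_ (toℚᵘ (recip (suc n))) (toℚᵘ (fromℕ (suc n))) ≈⟨ Uᴾ.*-cong (toℚᵘ-recip n) (toℚᵘ-fromℕ (suc n)) ⟩
    U._*_ (mkℚᵘ (+ 1) n) (mkℚᵘ (+ suc n) 0)             ≈⟨ *≡* cross ⟩
    U.1ℚᵘ                                               ∎)
    where
    cross : (+ 1 ℤ.* + suc n) ℤ.* + 1 ≡ + 1 ℤ.* + (suc n ℕ.* 1)
    cross = trans (ℤP.*-identityʳ _) (trans (ℤP.*-identityˡ _)
              (sym (trans (ℤP.*-identityˡ _) (cong +_ (ℕP.*-identityʳ (suc n))))))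

module Reindexing where

  open import Data.Rational using (ℚ; 0ℚ; 1ℚ; _*_)
  import Data.Rational.Properties as ℚP
  open import Data.List using (List)
  open import Data.List.Properties using (≡-dec)
  open import Data.List.Relation.Unary.All as All using (All)
  open import Data.Sum using (_⊎_; inj₁; inj₂)
  open import Data.Empty using (⊥-elim)
  open import Relation.Nullary using (Dec; yes; no)
  open import Relation.Binary.PropositionalEquality
  import Data.Nat as ℕ
  open import Defs using (Partition)
  open Sums

  _≟ᴾ_ : (u v : Partition) → Dec (u ≡ v)
  _≟ᴾ_ = ≡-dec ℕ._≟_

  δ : Partition → Partition → ℚ
  δ v w = when (v ≟ᴾ w) 1ℚ

  count : Partition → List Partition → ℚ
  count v L = ∑ L (δ v)

  δ-refl : ∀ v → δ v v ≡ 1ℚ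
  δ-refl v with v ≟ᴾ v
  ... | yes _ = refl
  ... | no v≢v = ⊥-elim (v≢v refl)

  δ-weight : (g : Partition → ℚ) (w v : Partition) → g w * δ w v ≡ g v * δ v w
  δ-weight g w v with w ≟ᴾ v
  δ-weight g w .w | yes refl rewrite δ-refl w = refl
  δ-weight g w v | no w≢v with v ≟ᴾ w
  ... | yes v≡w = ⊥-elim (w≢v (sym v≡w))
  ... | no _ = trans (ℚP.*-zeroʳ (g w)) (sym (ℚP.*-zeroʳ (g v)))

  OccursOnceIn : (Partition → ℚ) → List Partition → Partition → Set
  OccursOnceIn g L w = g w ≡ 0ℚ ⊎ count w L ≡ 1ℚ

  private
    ∑-weighted-by-count : {L L' : List Partition} (g : Partition → ℚ) → All (OccursOnceIn g L') L →
      ∑ L g ≡ ∑ L (λ w → g w * count w L')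
    ∑-weighted-by-count {L' = L'} g = ∑-congᴬ ∘ All.map weight
      where
      open import Function using (_∘_)
      weight : ∀ {w} → OccursOnceIn g L' w → g w ≡ g w * count w L'
      weight {w} (inj₁ gw≡0) = trans gw≡0 (sym (trans (cong (_* count w L') gw≡0) (ℚP.*-zeroˡ (count w L'))))
      weight {w} (inj₂ once) = sym (trans (cong (g w *_) once) (ℚP.*-identityʳ (g w)))

  ∑-reindex : (L L' : List Partition) (g : Partition → ℚ) →
    All (OccursOnceIn g L') L → All (OccursOnceIn g L) L' → ∑ L g ≡ ∑ L' g
  ∑-reindex L L' g once once' = begin
    ∑ L g                                        ≡⟨ ∑-weighted-by-count {L} {L'} g once ⟩
    ∑ L (λ w → g w * count w L')                 ≡⟨ ∑-cong L (λ w → sym (∑-*ˡ L' (g w) (δ w))) ⟩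
    ∑ L (λ w → ∑ L' (λ v → g w * δ w v))         ≡⟨ ∑-comm L L' (λ w v → g w * δ w v) ⟩
    ∑ L' (λ v → ∑ L (λ w → g w * δ w v))         ≡⟨ ∑-cong L' (λ v → ∑-cong L (λ w → δ-weight g w v)) ⟩
    ∑ L' (λ v → ∑ L (λ w → g v * δ v w))         ≡⟨ ∑-cong L' (λ v → ∑-*ˡ L (g v) (δ v)) ⟩
    ∑ L' (λ v → g v * count v L)                 ≡⟨ sym (∑-weighted-by-count {L'} {L} g once') ⟩
    ∑ L' g                                       ∎
    where open ≡-Reasoning

module SortedLists where

  open import Data.Nat as ℕ using (ℕ; zero; suc; _≤_; _<_; _≥_; _≤?_; _≟_; s≤s)
  import Data.Nat.Properties as ℕP
  open import Data.List using (List; []; _∷_; _++_; foldr; length)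
  import Data.List.Properties as Listᴾ
  open import Data.List.Relation.Unary.All using (All; []; _∷_)
  import Data.List.Relation.Unary.AllPairs as AllPairs
  open import Data.List.Relation.Unary.Linked as Linked using (Linked; []; [-]; _∷_)
  open import Data.List.Relation.Unary.Linked.Properties using (Linked⇒AllPairs)
  open import Data.List.Relation.Binary.Permutation.Propositional
    using (_↭_; refl; prep; swap; trans)
  import Data.List.Relation.Binary.Permutation.Propositional.Properties as ↭ᴾ
  open import Relation.Nullary using (yes; no; Dec; ¬_)
  open import Relation.Binary.PropositionalEquality as ≡ using (_≡_; cong; sym)
  open import Data.Empty using (⊥-elim)
  open import Data.Product using (_,_)
  open import Defs using (insert; union; sortP; mult; IsPartition)
  open import Data.Nat.Tactic.RingSolver using (solve-∀)
  open ≡.≡-Reasoning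

  Descending : List ℕ → Set
  Descending = Linked _≥_

  descending-bound : ∀ {x v} → Descending (x ∷ v) → All (_≤ x) v
  descending-bound d = AllPairs.head (Linked⇒AllPairs (λ x≥y y≥z → ℕP.≤-trans y≥z x≥y) d)

  descending-cons : ∀ {x v} → All (_≤ x) v → Descending v → Descending (x ∷ v)
  descending-cons [] _ = [-]
  descending-cons (y≤x ∷ _) d = y≤x ∷ d

  insert-≤ : ∀ {x y} m → y ≤ x → insert x (y ∷ m) ≡ x ∷ y ∷ m
  insert-≤ {x} {y} m y≤x with y ≤? x
  ... | yes _ = ≡.refl
  ... | no y≰x = ⊥-elim (y≰x y≤x)

  insert-≰ : ∀ {x y} m → ¬ y ≤ x → insert x (y ∷ m) ≡ y ∷ insert x m
  insert-≰ {x} {y} m y≰x with y ≤? x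
  ... | yes y≤x = ⊥-elim (y≰x y≤x)
  ... | no _ = ≡.refl

  insert-↭ : ∀ x m → insert x m ↭ x ∷ m
  insert-↭ x [] = refl
  insert-↭ x (y ∷ m) with y ≤? x
  ... | yes _ = refl
  ... | no _ = trans (prep y (insert-↭ x m)) (swap y x refl)

  union-↭ : ∀ l ν → union l ν ↭ l ++ ν
  union-↭ [] ν = refl
  union-↭ (x ∷ l) ν = trans (insert-↭ x (union l ν)) (prep x (union-↭ l ν))

  private
    insert-comm-above : ∀ x y z m → z ≤ x → z ≤ y → insert x (y ∷ z ∷ m) ≡ insert y (x ∷ z ∷ m)
    insert-comm-above x y z m z≤x z≤y = by-cases (y ≤? x) (x ≤? y)
      where
      by-cases : Dec (y ≤ x) → Dec (x ≤ y) → insert x (y ∷ z ∷ m) ≡ insert y (x ∷ z ∷ m)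
      by-cases (yes y≤x) (yes x≤y) rewrite ℕP.≤-antisym y≤x x≤y = ≡.refl
      by-cases (yes y≤x) (no x≰y) = begin
        insert x (y ∷ z ∷ m)  ≡⟨ insert-≤ (z ∷ m) y≤x ⟩
        x ∷ y ∷ z ∷ m         ≡⟨ cong (x ∷_) (sym (insert-≤ m z≤y)) ⟩
        x ∷ insert y (z ∷ m)  ≡⟨ sym (insert-≰ (z ∷ m) x≰y) ⟩
        insert y (x ∷ z ∷ m)  ∎
      by-cases (no y≰x) (yes x≤y) = begin
        insert x (y ∷ z ∷ m)  ≡⟨ insert-≰ (z ∷ m) y≰x ⟩
        y ∷ insert x (z ∷ m)  ≡⟨ cong (y ∷_) (insert-≤ m z≤x) ⟩
        y ∷ x ∷ z ∷ m         ≡⟨ sym (insert-≤ (z ∷ m) x≤y) ⟩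
        insert y (x ∷ z ∷ m)  ∎
      by-cases (no y≰x) (no x≰y) = ⊥-elim (y≰x (ℕP.≰⇒≥ x≰y))

  insert-comm : ∀ x y m → insert x (insert y m) ≡ insert y (insert x m)
  insert-comm x y [] with y ≤? x | x ≤? y
  ... | yes y≤x | yes x≤y rewrite ℕP.≤-antisym y≤x x≤y = ≡.refl
  ... | yes _ | no _ = ≡.refl
  ... | no _ | yes _ = ≡.refl
  ... | no y≰x | no x≰y = ⊥-elim (y≰x (ℕP.≰⇒≥ x≰y))
  insert-comm x y (z ∷ m) with z ≤? y | z ≤? x
  ... | yes z≤y | yes z≤x = insert-comm-above x y z m z≤x z≤y
  ... | yes z≤y | no z≰x = begin
      insert x (y ∷ z ∷ m)      ≡⟨ insert-≰ (z ∷ m) (λ y≤x → z≰x (ℕP.≤-trans z≤y y≤x)) ⟩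
      y ∷ insert x (z ∷ m)      ≡⟨ cong (y ∷_) (insert-≰ m z≰x) ⟩
      y ∷ z ∷ insert x m        ≡⟨ sym (insert-≤ (insert x m) z≤y) ⟩
      insert y (z ∷ insert x m) ∎
  ... | no z≰y | yes z≤x = begin
      insert x (z ∷ insert y m) ≡⟨ insert-≤ (insert y m) z≤x ⟩
      x ∷ z ∷ insert y m        ≡⟨ cong (x ∷_) (sym (insert-≰ m z≰y)) ⟩
      x ∷ insert y (z ∷ m)      ≡⟨ sym (insert-≰ (z ∷ m) (λ x≤y → z≰y (ℕP.≤-trans z≤x x≤y))) ⟩
      insert y (x ∷ z ∷ m)      ∎
  ... | no z≰y | no z≰x = begin
      insert x (z ∷ insert y m) ≡⟨ insert-≰ (insert y m) z≰x ⟩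
      z ∷ insert x (insert y m) ≡⟨ cong (z ∷_) (insert-comm x y m) ⟩
      z ∷ insert y (insert x m) ≡⟨ sym (insert-≰ (insert x m) z≰y) ⟩
      insert y (z ∷ insert x m) ∎

  sort : List ℕ → List ℕ
  sort = foldr insert []

  sort-↭ : ∀ {l l'} → l ↭ l' → sort l ≡ sort l'
  sort-↭ refl = ≡.refl
  sort-↭ (prep x p) = cong (insert x) (sort-↭ p)
  sort-↭ (swap {ys = ys} x y p) =
    ≡.trans (cong (λ m → insert x (insert y m)) (sort-↭ p)) (insert-comm x y (sort ys))
  sort-↭ (trans p q) = ≡.trans (sort-↭ p) (sort-↭ q)

  insert-descending : ∀ x {m} → Descending m → Descending (insert x m)
  insert-descending x [] = [-]
  insert-descending x {y ∷ []} [-] with y ≤? x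
  ... | yes y≤x = y≤x ∷ [-]
  ... | no y≰x = ℕP.≰⇒≥ y≰x ∷ [-]
  insert-descending x {y ∷ w ∷ m} (y≥w ∷ d) with y ≤? x
  ... | yes y≤x = y≤x ∷ y≥w ∷ d
  ... | no y≰x with insert-descending x d
  ...   | d' with w ≤? x
  ...     | yes _ = ℕP.≰⇒≥ y≰x ∷ d'
  ...     | no _ = y≥w ∷ d'

  union-descending : ∀ l {ν} → Descending ν → Descending (union l ν)
  union-descending [] d = d
  union-descending (x ∷ l) d = insert-descending x (union-descending l d)

  insert-head : ∀ x m → Descending (x ∷ m) → insert x m ≡ x ∷ m
  insert-head x [] _ = ≡.refl
  insert-head x (y ∷ m) (x≥y ∷ _) = insert-≤ m x≥y

  sort-descending : ∀ {m} → Descending m → sort m ≡ m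
  sort-descending [] = ≡.refl
  sort-descending [-] = ≡.refl
  sort-descending {x ∷ y ∷ m} (x≥y ∷ d) rewrite sort-descending d = insert-≤ m x≥y

  insert-injective-tail : ∀ x L M → insert x L ≡ x ∷ M → L ≡ M
  insert-injective-tail x [] M ≡.refl = ≡.refl
  insert-injective-tail x (y ∷ L) M e with y ≤? x
  insert-injective-tail x (y ∷ L) M ≡.refl | yes _ = ≡.refl
  insert-injective-tail x (y ∷ L) M ≡.refl | no x≰x = ⊥-elim (x≰x ℕP.≤-refl)

  sort-++ : ∀ l m → sort (l ++ m) ≡ foldr insert (sort m) l
  sort-++ [] m = ≡.refl
  sort-++ (x ∷ l) m = cong (insert x) (sort-++ l m)

  union-sort : ∀ l {ν} → Descending ν → union l ν ≡ sort (l ++ ν)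
  union-sort l {ν} d = ≡.trans (cong (λ m → foldr insert m l) (sym (sort-descending d))) (sym (sort-++ l ν))

  union-cons-right : ∀ l x ν → Descending (x ∷ ν) → union l (x ∷ ν) ≡ insert x (union l ν)
  union-cons-right l x ν d = begin
    union l (x ∷ ν)          ≡⟨ union-sort l d ⟩
    sort (l ++ x ∷ ν)        ≡⟨ sort-↭ (↭ᴾ.shift x l ν) ⟩
    insert x (sort (l ++ ν)) ≡⟨ cong (insert x) (sym (union-sort l (Linked.tail d))) ⟩
    insert x (union l ν)     ∎

  length-union : ∀ l ν → length (union l ν) ≡ length l ℕ.+ length ν
  length-union l ν = ≡.trans (↭ᴾ.↭-length (union-↭ l ν)) (Listᴾ.length-++ l)

  sortP-positive : ∀ {l} → All (0 <_) l → sortP l ≡ sort l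
  sortP-positive [] = ≡.refl
  sortP-positive {suc x ∷ l} (s≤s _ ∷ ps) = cong (insert (suc x)) (sortP-positive ps)

  sortP-descending : ∀ l → Descending (sortP l)
  sortP-descending [] = []
  sortP-descending (zero ∷ l) = sortP-descending l
  sortP-descending (suc x ∷ l) = insert-descending (suc x) (sortP-descending l)

  sortP-partition : ∀ {μ} → IsPartition μ → sortP μ ≡ μ
  sortP-partition (ps , d) = ≡.trans (sortP-positive ps) (sort-descending d)

  mult-≡ : ∀ {i x} l → i ≡ x → mult i (x ∷ l) ≡ suc (mult i l)
  mult-≡ {i} {x} l i≡x with i ≟ x
  ... | yes _ = ≡.refl
  ... | no i≢x = ⊥-elim (i≢x i≡x)

  mult-≢ : ∀ {i x} l → ¬ i ≡ x → mult i (x ∷ l) ≡ mult i l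
  mult-≢ {i} {x} l i≢x with i ≟ x
  ... | yes i≡x = ⊥-elim (i≢x i≡x)
  ... | no _ = ≡.refl

  mult-head : ∀ x l → mult x (x ∷ l) ≡ suc (mult x l)
  mult-head x l = mult-≡ l ≡.refl

  mult-absent : ∀ {i} l → All (λ y → ¬ i ≡ y) l → mult i l ≡ 0
  mult-absent [] [] = ≡.refl
  mult-absent (y ∷ l) (i≢y ∷ h) = ≡.trans (mult-≢ l i≢y) (mult-absent l h)

  mult-++ : ∀ i l m → mult i (l ++ m) ≡ mult i l ℕ.+ mult i m
  mult-++ i [] m = ≡.refl
  mult-++ i (x ∷ l) m with i ≟ x
  ... | yes _ = cong suc (mult-++ i l m)
  ... | no _ = mult-++ i l m

  private
    mult-∷ : ∀ i x {l l'} → mult i l ≡ mult i l' → mult i (x ∷ l) ≡ mult i (x ∷ l')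
    mult-∷ i x e with i ≟ x
    ... | yes _ = cong suc e
    ... | no _ = e

    mult-swap : ∀ i x y l → mult i (x ∷ y ∷ l) ≡ mult i (y ∷ x ∷ l)
    mult-swap i x y l = begin
      mult i (x ∷ y ∷ l)                        ≡⟨ mult-++ i [x] (y ∷ l) ⟩
      mult i [x] ℕ.+ mult i (y ∷ l)             ≡⟨ cong (mult i [x] ℕ.+_) (mult-++ i [y] l) ⟩
      mult i [x] ℕ.+ (mult i [y] ℕ.+ mult i l)  ≡⟨ exchange (mult i [x]) (mult i [y]) (mult i l) ⟩
      mult i [y] ℕ.+ (mult i [x] ℕ.+ mult i l)  ≡⟨ cong (mult i [y] ℕ.+_) (sym (mult-++ i [x] l)) ⟩
      mult i [y] ℕ.+ mult i (x ∷ l)             ≡⟨ sym (mult-++ i [y] (x ∷ l)) ⟩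
      mult i (y ∷ x ∷ l)                        ∎
      where
      [x] [y] : List ℕ
      [x] = x ∷ []
      [y] = y ∷ []
      exchange : ∀ a b c → a ℕ.+ (b ℕ.+ c) ≡ b ℕ.+ (a ℕ.+ c)
      exchange = solve-∀

  mult-↭ : ∀ i {l l'} → l ↭ l' → mult i l ≡ mult i l'
  mult-↭ i refl = ≡.refl
  mult-↭ i (prep x p) = mult-∷ i x (mult-↭ i p)
  mult-↭ i (swap {xs} x y p) = ≡.trans (mult-swap i x y xs) (mult-∷ i y (mult-∷ i x (mult-↭ i p)))
  mult-↭ i (trans p q) = ≡.trans (mult-↭ i p) (mult-↭ i q)

module PartitionEnumeration where

  open import Data.Nat as ℕ using (ℕ; zero; suc; _≤_; _<_; _≤?_; z≤n; s≤s; _∸_)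
  import Data.Nat.Properties as ℕP
  open import Data.Nat.ListAction using (sum)
  open import Data.Rational using (ℚ; 0ℚ; 1ℚ; _+_)
  import Data.Rational.Properties as ℚP
  open import Data.List using (List; []; _∷_; map; concatMap; filter; upTo; applyUpTo)
  open import Data.List.Relation.Unary.All as All using (All; []; _∷_)
  import Data.List.Relation.Unary.All.Properties as Allᴾ
  open import Data.List.Relation.Unary.Linked as Linked using ([])
  open import Relation.Nullary using (yes; no; Dec; ¬_)
  open import Relation.Binary.PropositionalEquality
  open import Data.Empty using (⊥-elim)
  open import Data.Product using (_×_; _,_; proj₁; proj₂)
  open import Function using (_∘_)
  open import Defs using (Partition; partsF; partitions; partitionsUpTo; IsPartition)
  open Sums
  open Reindexing
  open SortedLists

  BoundedPartitionOf : ℕ → ℕ → Partition → Set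
  BoundedPartitionOf n m v = All (0 <_) v × Descending v × sum v ≡ n × All (_≤ m) v

  PartitionUpTo : ℕ → Partition → Set
  PartitionUpTo M v = IsPartition v × sum v ≤ M

  private
    All-concatMap : ∀ {A B : Set} {Q : B → Set} (f : A → List B) {L : List A} →
      All (λ j → All Q (f j)) L → All Q (concatMap f L)
    All-concatMap f h = Allᴾ.concat⁺ (Allᴾ.map⁺ h)

    All-upTo : ∀ {P : ℕ → Set} n → (∀ {i} → i < n → P i) → All P (upTo n)
    All-upTo n h = Allᴾ.applyUpTo⁺₁ (λ i → i) n h

    bounded-cons : ∀ {n j m v} → j ≤ n → suc j ≤ m →
      BoundedPartitionOf (n ∸ j) (suc j) v → BoundedPartitionOf (suc n) m (suc j ∷ v)
    bounded-cons {n} {j} {m} {v} j≤n j<m (pos , desc , sum≡ , bound) =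
      s≤s z≤n ∷ pos ,
      descending-cons bound desc ,
      trans (cong (suc j ℕ.+_) sum≡) (cong suc (ℕP.m+[n∸m]≡n j≤n)) ,
      j<m ∷ All.map (λ q → ℕP.≤-trans q j<m) bound

    first-parts : ∀ n m → All (λ j → j < suc n × suc j ≤ m) (filter (λ j → suc j ≤? m) (upTo (suc n)))
    first-parts n m = All.zip (Allᴾ.filter⁺ (λ j → suc j ≤? m) (All-upTo (suc n) (λ i → i)) ,
                               Allᴾ.all-filter (λ j → suc j ≤? m) (upTo (suc n)))

  partsF-sound : ∀ fuel n m → All (BoundedPartitionOf n m) (partsF fuel n m)
  partsF-sound fuel zero m = ([] , [] , refl , []) ∷ []
  partsF-sound zero (suc n) m = []
  partsF-sound (suc fuel) (suc n) m = All-concatMap _ (All.map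
    (λ {j} bounds → Allᴾ.map⁺ (All.map (bounded-cons (ℕP.≤-pred (proj₁ bounds)) (proj₂ bounds))
                                       (partsF-sound fuel (n ∸ j) (suc j))))
    (first-parts n m))

  δ-≢ : ∀ {v w} → ¬ v ≡ w → δ v w ≡ 0ℚ
  δ-≢ {v} {w} v≢w with v ≟ᴾ w
  ... | yes v≡w = ⊥-elim (v≢w v≡w)
  ... | no _ = refl

  count-absent : ∀ {v} {L : List Partition} → All (λ w → ¬ v ≡ w) L → count v L ≡ 0ℚ
  count-absent {v} h = ∑-zeroᴬ (δ v) (All.map δ-≢ h)

  private
    ∷-injectiveˡ : ∀ {a b : ℕ} {v w : List ℕ} → a ∷ v ≡ b ∷ w → a ≡ b
    ∷-injectiveˡ refl = refl

    ∷-injectiveʳ : ∀ {a b : ℕ} {v w : List ℕ} → a ∷ v ≡ b ∷ w → v ≡ w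
    ∷-injectiveʳ refl = refl

    δ-resp : ∀ {v w v' w'} → (v ≡ w → v' ≡ w') → (v' ≡ w' → v ≡ w) → δ v w ≡ δ v' w'
    δ-resp {v} {w} {v'} {w'} to from with v ≟ᴾ w | v' ≟ᴾ w'
    ... | yes _ | yes _ = refl
    ... | yes e | no ne = ⊥-elim (ne (to e))
    ... | no ne | yes e = ⊥-elim (ne (from e))
    ... | no _ | no _ = refl

    δ-∷ : ∀ a v w → δ (a ∷ v) (a ∷ w) ≡ δ v w
    δ-∷ a v w = δ-resp ∷-injectiveʳ (cong (a ∷_))

  count-map-∷ : ∀ a v L → count (a ∷ v) (map (a ∷_) L) ≡ count v L
  count-map-∷ a v [] = refl
  count-map-∷ a v (w ∷ L) = cong₂ _+_ (δ-∷ a v w) (count-map-∷ a v L)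

  count-map-∷-≢ : ∀ {a b} v L → ¬ a ≡ b → count (a ∷ v) (map (b ∷_) L) ≡ 0ℚ
  count-map-∷-≢ v L a≢b =
    count-absent (Allᴾ.map⁺ (All.universal (λ w e → a≢b (∷-injectiveˡ e)) L))

  ∑-applyUpTo-single : ∀ (f : ℕ → ℕ) k t (g : ℕ → ℚ) → t < k →
    (∀ n → n < k → ¬ n ≡ t → g (f n) ≡ 0ℚ) → ∑ (applyUpTo f k) g ≡ g (f t)
  ∑-applyUpTo-single f (suc k) zero g t<k others =
    trans (cong (g (f 0) +_) (∑-zeroᴬ g (Allᴾ.applyUpTo⁺₁ (f ∘ suc) k
                                           (λ {i} i<k → others (suc i) (s≤s i<k) (λ ())))))
          (ℚP.+-identityʳ _)
  ∑-applyUpTo-single f (suc k) (suc t) g (s≤s t<k) others =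
    trans (cong (_+ ∑ (applyUpTo (f ∘ suc) k) g) (others 0 (s≤s z≤n) (λ ())))
      (trans (ℚP.+-identityˡ _)
        (∑-applyUpTo-single (f ∘ suc) k t g t<k
          (λ n n<k n≢t → others (suc n) (s≤s n<k) (n≢t ∘ ℕP.suc-injective))))

  count-partsF : ∀ fuel n m v → n ≤ fuel → BoundedPartitionOf n m v → count v (partsF fuel n m) ≡ 1ℚ
  count-partsF fuel zero m [] _ _ = trans (cong (_+ 0ℚ) (δ-refl [])) (ℚP.+-identityʳ 1ℚ)
  count-partsF fuel zero m (suc x ∷ v) _ (_ , _ , () , _)
  count-partsF fuel n m (zero ∷ v) _ (() ∷ _ , _)
  count-partsF zero (suc n) m v () _
  count-partsF (suc fuel) (suc n) m [] _ (_ , _ , () , _)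
  count-partsF (suc fuel) (suc n) m (suc j₀ ∷ v') (s≤s n≤fuel) (s≤s z≤n ∷ pos , desc , sum≡ , j₀<m ∷ _) =
    begin
      ∑ (concatMap block (filter fits? (upTo (suc n)))) (δ v)   ≡⟨ ∑-concatMap block (filter fits? (upTo (suc n))) (δ v) ⟩
      ∑ (filter fits? (upTo (suc n))) (λ j → count v (block j)) ≡⟨ ∑-filter fits? (upTo (suc n)) _ ⟩
      ∑ (upTo (suc n)) countAt                                  ≡⟨ ∑-applyUpTo-single (λ i → i) (suc n) j₀ countAt (s≤s j₀≤n) elsewhere ⟩
      countAt j₀                                                ≡⟨ at-j₀ (fits? j₀) ⟩
      1ℚ                                                        ∎
    where
    open ≡-Reasoning
    v = suc j₀ ∷ v'
    fits? = λ j → suc j ≤? m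
    block = λ j → map (suc j ∷_) (partsF fuel (suc n ∸ suc j) (suc j))
    countAt : ℕ → ℚ
    countAt j = when (fits? j) (count v (block j))
    j₀≤n : j₀ ≤ n
    j₀≤n = ℕP.≤-pred (subst (suc j₀ ≤_) sum≡ (ℕP.m≤m+n (suc j₀) (sum v')))
    sum-tail : sum v' ≡ n ∸ j₀
    sum-tail = trans (sym (ℕP.m+n∸m≡n j₀ (sum v'))) (cong (_∸ j₀) (ℕP.suc-injective sum≡))
    when-zero : ∀ {q} {Q : Set q} (d : Dec Q) {x} → x ≡ 0ℚ → when d x ≡ 0ℚ
    when-zero (yes _) e = e
    when-zero (no _) e = refl
    elsewhere : ∀ j → j < suc n → ¬ j ≡ j₀ → countAt j ≡ 0ℚ
    elsewhere j _ j≢j₀ = when-zero (fits? j)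
      (count-map-∷-≢ v' (partsF fuel (n ∸ j) (suc j)) (λ e → j≢j₀ (sym (ℕP.suc-injective e))))
    at-j₀ : (d : Dec (suc j₀ ≤ m)) → when d (count v (block j₀)) ≡ 1ℚ
    at-j₀ (no j₀≮m) = ⊥-elim (j₀≮m j₀<m)
    at-j₀ (yes _) = trans (count-map-∷ (suc j₀) v' (partsF fuel (n ∸ j₀) (suc j₀)))
      (count-partsF fuel (n ∸ j₀) (suc j₀) v' (ℕP.≤-trans (ℕP.m∸n≤m n j₀) n≤fuel)
        (pos , Linked.tail desc , sum-tail , descending-bound desc))

  parts-≤-sum : ∀ v → All (_≤ sum v) v
  parts-≤-sum [] = []
  parts-≤-sum (x ∷ v) = ℕP.m≤m+n x (sum v) ∷ All.map (λ q → ℕP.≤-trans q (ℕP.m≤n+m (sum v) x)) (parts-≤-sum v)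

  count-partitionsUpTo : ∀ M v → PartitionUpTo M v → count v (partitionsUpTo M) ≡ 1ℚ
  count-partitionsUpTo M v ((pos , desc) , sum≤M) = begin
    ∑ (concatMap partitions (upTo (suc M))) (δ v)   ≡⟨ ∑-concatMap partitions (upTo (suc M)) (δ v) ⟩
    ∑ (upTo (suc M)) (λ n → count v (partitions n)) ≡⟨ ∑-applyUpTo-single (λ i → i) (suc M) (sum v) _ (s≤s sum≤M) other-sizes ⟩
    count v (partitions (sum v))                    ≡⟨ count-partsF (sum v) (sum v) (sum v) v ℕP.≤-refl (pos , desc , refl , parts-≤-sum v) ⟩
    1ℚ                                              ∎
    where
    open ≡-Reasoning
    other-sizes : ∀ n → n < suc M → ¬ n ≡ sum v → count v (partitions n) ≡ 0ℚ
    other-sizes n _ n≢ = count-absent {v} (All.map (λ h e → n≢ (sym (trans (cong sum e) (proj₁ (proj₂ (proj₂ h))))))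
                                               (partsF-sound n n n))

  partitionsUpTo-sound : ∀ M → All (PartitionUpTo M) (partitionsUpTo M)
  partitionsUpTo-sound M = All-concatMap partitions (All-upTo (suc M) (λ {n} n<sM →
    All.map (λ {v} h → (proj₁ h , proj₁ (proj₂ h)) , subst (_≤ M) (sym (proj₁ (proj₂ (proj₂ h)))) (ℕP.≤-pred n<sM))
            (partsF-sound n n n)))

module CentralizerOrder where

  open import Data.Nat using (ℕ; zero; suc; _≤_; _<_; _≟_; s≤s; _+_; _*_; _^_; _!)
  import Data.Nat.Properties as ℕP
  open import Data.Nat.ListAction using (sum)
  open import Data.List using (List; _∷_; foldr; applyUpTo)
  import Data.List.Relation.Unary.All as All
  open import Relation.Nullary using (yes; no)
  open import Relation.Binary.PropositionalEquality
  open import Function using (_∘_)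
  open import Data.Nat.Tactic.RingSolver using (solve-∀)
  open import Defs using (z; mult)
  open SortedLists using (mult-≢; mult-head; mult-absent)
  open PartitionEnumeration using (parts-≤-sum)
  open ≡-Reasoning

  ∏<_ : ℕ → (ℕ → ℕ) → ℕ
  ∏< n = λ f → foldr _*_ 1 (applyUpTo f n)

  ∏<-suc : ∀ f n → (∏< suc n) f ≡ (∏< n) f * f n
  ∏<-suc f zero = ℕP.*-comm (f 0) 1
  ∏<-suc f (suc n) = trans (cong (f 0 *_) (∏<-suc (λ i → f (suc i)) n)) (sym (ℕP.*-assoc (f 0) _ _))

  ∏<-cong : ∀ {f g} n → (∀ i → i < n → f i ≡ g i) → (∏< n) f ≡ (∏< n) g
  ∏<-cong zero _ = refl
  ∏<-cong {f} {g} (suc n) f≗g = begin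
    (∏< suc n) f      ≡⟨ ∏<-suc f n ⟩
    (∏< n) f * f n    ≡⟨ cong₂ _*_ (∏<-cong n (λ i i<n → f≗g i (ℕP.m<n⇒m<1+n i<n))) (f≗g n ℕP.≤-refl) ⟩
    (∏< n) g * g n    ≡⟨ sym (∏<-suc g n) ⟩
    (∏< suc n) g      ∎

  zFactor : List ℕ → ℕ → ℕ
  zFactor l j = (suc j ^ mult (suc j) l) * (mult (suc j) l !)

  zUpTo : ℕ → List ℕ → ℕ
  zUpTo n l = (∏< n) (zFactor l)

  zUpTo-beyond : ∀ l d → zUpTo (sum l + d) l ≡ z l
  zUpTo-beyond l zero = cong (λ n → zUpTo n l) (ℕP.+-identityʳ (sum l))
  zUpTo-beyond l (suc d) = begin
    zUpTo (sum l + suc d) l                         ≡⟨ cong (λ n → zUpTo n l) (ℕP.+-suc (sum l) d) ⟩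
    zUpTo (suc (sum l + d)) l                       ≡⟨ ∏<-suc (zFactor l) (sum l + d) ⟩
    zUpTo (sum l + d) l * zFactor l (sum l + d)     ≡⟨ cong₂ _*_ (zUpTo-beyond l d) trivial-factor ⟩
    z l * 1                                         ≡⟨ ℕP.*-identityʳ (z l) ⟩
    z l                                             ∎
    where
    too-large : mult (suc (sum l + d)) l ≡ 0
    too-large = mult-absent l (All.map (λ q e → ℕP.<-irrefl (sym e) (s≤s (ℕP.≤-trans q (ℕP.m≤m+n (sum l) d))))
                                       (parts-≤-sum l))
    trivial-factor : zFactor l (sum l + d) ≡ 1
    trivial-factor rewrite too-large = refl

  zUpTo-below : ∀ x l n → n < x → zUpTo n (x ∷ l) ≡ zUpTo n l
  zUpTo-below x l n n<x = ∏<-cong n (λ i i<n →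
    cong (λ m → (suc i ^ m) * (m !)) (mult-≢ l (λ e → ℕP.<-irrefl e (ℕP.≤-trans (s≤s i<n) n<x))))

  zUpTo-∷ : ∀ x l n → 0 < x → x ≤ n → zUpTo n (x ∷ l) ≡ zUpTo n l * (x * suc (mult x l))
  zUpTo-∷ (suc _) l zero 0<x ()
  zUpTo-∷ x l (suc n) 0<x x≤1+n with x ≟ suc n
  ... | yes refl = begin
    zUpTo (suc n) (suc n ∷ l)                 ≡⟨ ∏<-suc (zFactor (suc n ∷ l)) n ⟩
    zUpTo n (suc n ∷ l) * zFactor (suc n ∷ l) n
      ≡⟨ cong₂ _*_ (zUpTo-below (suc n) l n ℕP.≤-refl) (cong (λ m → (suc n ^ m) * (m !)) (mult-head (suc n) l)) ⟩
    zUpTo n l * ((suc n ^ suc m) * (suc m !)) ≡⟨ rearrange (zUpTo n l) (suc n) (suc n ^ m) (m !) m ⟩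
    (zUpTo n l * zFactor l n) * (suc n * suc m) ≡⟨ cong (_* (suc n * suc m)) (sym (∏<-suc (zFactor l) n)) ⟩
    zUpTo (suc n) l * (suc n * suc m)         ∎
    where
    m = mult (suc n) l
    rearrange : ∀ Z X A B M → Z * ((X * A) * ((1 + M) * B)) ≡ (Z * (A * B)) * (X * (1 + M))
    rearrange = solve-∀
  ... | no x≢1+n = begin
    zUpTo (suc n) (x ∷ l)                     ≡⟨ ∏<-suc (zFactor (x ∷ l)) n ⟩
    zUpTo n (x ∷ l) * zFactor (x ∷ l) n
      ≡⟨ cong₂ _*_ (zUpTo-∷ x l n 0<x (ℕP.≤-pred (ℕP.≤∧≢⇒< x≤1+n x≢1+n)))
                   (cong (λ m → (suc n ^ m) * (m !)) (mult-≢ l (x≢1+n ∘ sym))) ⟩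
    (zUpTo n l * c) * zFactor l n             ≡⟨ rearrange (zUpTo n l) c (zFactor l n) ⟩
    (zUpTo n l * zFactor l n) * c             ≡⟨ cong (_* c) (sym (∏<-suc (zFactor l) n)) ⟩
    zUpTo (suc n) l * c                       ∎
    where
    c = x * suc (mult x l)
    rearrange : ∀ A B C → (A * B) * C ≡ (A * C) * B
    rearrange = solve-∀

  z-∷ : ∀ x l → 0 < x → z (x ∷ l) ≡ z l * (x * suc (mult x l))
  z-∷ x l 0<x = begin
    z (x ∷ l)                          ≡⟨ zUpTo-∷ x l (x + sum l) 0<x (ℕP.m≤m+n x (sum l)) ⟩
    zUpTo (x + sum l) l * c            ≡⟨ cong (λ n → zUpTo n l * c) (ℕP.+-comm x (sum l)) ⟩
    zUpTo (sum l + x) l * c            ≡⟨ cong (_* c) (zUpTo-beyond l x) ⟩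
    z l * c                            ∎
    where
    c = x * suc (mult x l)

module Evaluation where

  import Data.Nat as ℕ
  open import Data.Rational using (ℚ; _+_; _*_)
  import Data.Rational.Properties as ℚP
  open import Data.List using ([]; _∷_)
  open import Data.List.Relation.Binary.Permutation.Propositional using (_↭_; ↭-sym; ↭-trans)
  import Data.List.Relation.Binary.Permutation.Propositional.Properties as ↭ᴾ
  open import Data.Product using (_,_; proj₁; proj₂)
  open import Relation.Nullary using (yes; no)
  open import Relation.Binary.Bundles using (Setoid)
  import Relation.Binary.Reasoning.Setoid
  open import Relation.Binary.PropositionalEquality
  open import Function using (_∘_)
  open import Tactic.RingSolver using (solve-∀)
  open import Defs
  open Sums
  open Reindexing using (δ; _≟ᴾ_)
  open SortedLists using (union-↭)

  eval : (Partition → ℚ) → Sym → ℚ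
  eval h f = ∑ f (λ t → proj₁ t * h (proj₂ t))

  eval-cong : ∀ {h h'} (f : Sym) → (∀ l → h l ≡ h' l) → eval h f ≡ eval h' f
  eval-cong f h≗h' = ∑-cong f (λ t → cong (proj₁ t *_) (h≗h' (proj₂ t)))

  eval-⊕ : ∀ h f g → eval h (f ⊕ g) ≡ eval h f + eval h g
  eval-⊕ h f g = ∑-++ f g _

  eval-⊙ : ∀ h c f → eval h (c ⊙ f) ≡ c * eval h f
  eval-⊙ h c f = trans (∑-map _ f _) (trans (∑-cong f (λ t → ℚP.*-assoc c (proj₁ t) (h (proj₂ t)))) (∑-*ˡ f c _))

  eval-⊗ : ∀ h f g → eval h (f ⊗ g) ≡ eval (λ l → eval (λ ν → h (union l ν)) g) f
  eval-⊗ h f g = trans (∑-concatMap _ f _) (∑-cong f (λ t → trans (∑-map _ g _)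
    (trans (∑-cong g (λ s → ℚP.*-assoc (proj₁ t) (proj₁ s) (h (union (proj₂ t) (proj₂ s))))) (∑-*ˡ g (proj₁ t) _))))

  eval-⊗ʳ : ∀ h f g → eval h (f ⊗ g) ≡ eval (λ ν → eval (λ l → h (union l ν)) f) g
  eval-⊗ʳ h f g = trans (eval-⊗ h f g) (trans (∑-cong f (λ t → sym (∑-*ˡ g (proj₁ t) _)))
    (trans (∑-comm f g (λ t s → proj₁ t * (proj₁ s * h (union (proj₂ t) (proj₂ s)))))
    (∑-cong g (λ s → trans (∑-cong f (λ t → exchange (proj₁ t) (proj₁ s) (h (union (proj₂ t) (proj₂ s))))) (∑-*ˡ f (proj₁ s) _)))))
    where
    exchange : ∀ a b c → a * (b * c) ≡ b * (a * c)
    exchange = solve-∀ ℚ-ring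

  eval-p : ∀ h l → eval h (p l) ≡ h (sortP l)
  eval-p h l = trans (ℚP.+-identityʳ _) (ℚP.*-identityˡ _)

  eval-sumS : ∀ h L → eval h (sumS L) ≡ ∑ L (eval h)
  eval-sumS h [] = refl
  eval-sumS h (f ∷ L) = trans (eval-⊕ h f (sumS L)) (cong (eval h f +_) (eval-sumS h L))

  coeff-eval : ∀ f la → coeff f la ≡ eval (λ ν → δ ν la) f
  coeff-eval [] la = refl
  coeff-eval ((c , ν) ∷ f) la with ν ≟ᴾ la
  ... | yes _ = cong₂ _+_ (sym (ℚP.*-identityʳ c)) (coeff-eval f la)
  ... | no _ = trans (coeff-eval f la) (sym (trans (cong (_+ eval (λ ν → δ ν la) f) (ℚP.*-zeroʳ c)) (ℚP.+-identityˡ _)))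

  Symmetric : (Partition → ℚ) → Set
  Symmetric h = ∀ {l l'} → l ↭ l' → h l ≡ h l'

  -- Equality of the represented symmetric functions; ⊗ is commutative and associative only up to ≃.
  infix 4 _≃_
  record _≃_ (f g : Sym) : Set where
    constructor mk≃
    field eval-≡ : ∀ h → Symmetric h → eval h f ≡ eval h g
  open _≃_ public

  ≃-setoid : Setoid _ _
  ≃-setoid = record
    { Carrier = Sym
    ; _≈_ = _≃_
    ; isEquivalence = record
      { refl = mk≃ λ _ _ → refl
      ; sym = λ f≃g → mk≃ λ h s → sym (eval-≡ f≃g h s)
      ; trans = λ f≃g g≃k → mk≃ λ h s → trans (eval-≡ f≃g h s) (eval-≡ g≃k h s)
      }
    }

  open Setoid ≃-setoid public using () renaming (refl to ≃-refl; reflexive to ≃-reflexive; sym to ≃-sym; trans to ≃-trans)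
  module ≃-Reasoning = Relation.Binary.Reasoning.Setoid ≃-setoid

  private
    union-↭ˡ : ∀ {l l'} ν → l ↭ l' → union l ν ↭ union l' ν
    union-↭ˡ {l} {l'} ν p = ↭-trans (union-↭ l ν) (↭-trans (↭ᴾ.++⁺ʳ ν p) (↭-sym (union-↭ l' ν)))

    union-↭ʳ : ∀ l {ν ν'} → ν ↭ ν' → union l ν ↭ union l ν'
    union-↭ʳ l {ν} {ν'} p = ↭-trans (union-↭ l ν) (↭-trans (↭ᴾ.++⁺ˡ l p) (↭-sym (union-↭ l ν')))

    union-comm-↭ : ∀ l ν → union l ν ↭ union ν l
    union-comm-↭ l ν = ↭-trans (union-↭ l ν) (↭-trans (↭ᴾ.++-comm l ν) (↭-sym (union-↭ ν l)))

    union-assoc-↭ : ∀ l ν ρ → union (union l ν) ρ ↭ union l (union ν ρ)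
    union-assoc-↭ l ν ρ =
      ↭-trans (union-↭ (union l ν) ρ) (↭-trans (↭ᴾ.++⁺ʳ ρ (union-↭ l ν))
      (↭-trans (↭ᴾ.++-assoc l ν ρ) (↭-sym (↭-trans (union-↭ l (union ν ρ)) (↭ᴾ.++⁺ˡ l (union-↭ ν ρ))))))

    eval-shift-symmetric : ∀ {h} g → Symmetric h → Symmetric (λ l → eval (λ ν → h (union l ν)) g)
    eval-shift-symmetric g s p = eval-cong g (λ ν → s (union-↭ˡ ν p))

  ⊕-cong : ∀ {f f' g g'} → f ≃ f' → g ≃ g' → f ⊕ g ≃ f' ⊕ g'
  ⊕-cong {f} {f'} {g} {g'} f≃f' g≃g' = mk≃ λ h s →
    trans (eval-⊕ h f g) (trans (cong₂ _+_ (eval-≡ f≃f' h s) (eval-≡ g≃g' h s)) (sym (eval-⊕ h f' g')))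

  ⊗-cong : ∀ {f f' g g'} → f ≃ f' → g ≃ g' → f ⊗ g ≃ f' ⊗ g'
  ⊗-cong {f} {f'} {g} {g'} f≃f' g≃g' = mk≃ λ h s → begin
    eval h (f ⊗ g)                                ≡⟨ eval-⊗ h f g ⟩
    eval (λ l → eval (λ ν → h (union l ν)) g) f   ≡⟨ eval-cong f (λ l → eval-≡ g≃g' _ (s ∘ union-↭ʳ l)) ⟩
    eval (λ l → eval (λ ν → h (union l ν)) g') f  ≡⟨ eval-≡ f≃f' _ (eval-shift-symmetric g' s) ⟩
    eval (λ l → eval (λ ν → h (union l ν)) g') f' ≡⟨ sym (eval-⊗ h f' g') ⟩
    eval h (f' ⊗ g')                              ∎
    where
    open ≡-Reasoning

  ⊗-congˡ : ∀ {f f'} g → f ≃ f' → f ⊗ g ≃ f' ⊗ g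
  ⊗-congˡ g f≃f' = ⊗-cong f≃f' (≃-refl {g})

  ⊗-congʳ : ∀ f {g g'} → g ≃ g' → f ⊗ g ≃ f ⊗ g'
  ⊗-congʳ f g≃g' = ⊗-cong (≃-refl {f}) g≃g'

  ⊗-comm : ∀ f g → f ⊗ g ≃ g ⊗ f
  ⊗-comm f g = mk≃ λ h s →
    trans (eval-⊗ h f g) (trans (eval-cong f (λ l → eval-cong g (λ ν → s (union-comm-↭ l ν)))) (sym (eval-⊗ʳ h g f)))

  ⊗-assoc : ∀ f g k → (f ⊗ g) ⊗ k ≃ f ⊗ (g ⊗ k)
  ⊗-assoc f g k = mk≃ λ h s → begin
    eval h ((f ⊗ g) ⊗ k)                                                      ≡⟨ eval-⊗ h (f ⊗ g) k ⟩
    eval (λ m → eval (λ ρ → h (union m ρ)) k) (f ⊗ g)                         ≡⟨ eval-⊗ _ f g ⟩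
    eval (λ l → eval (λ ν → eval (λ ρ → h (union (union l ν) ρ)) k) g) f
      ≡⟨ eval-cong f (λ l → eval-cong g (λ ν → eval-cong k (λ ρ → s (union-assoc-↭ l ν ρ)))) ⟩
    eval (λ l → eval (λ ν → eval (λ ρ → h (union l (union ν ρ))) k) g) f
      ≡⟨ eval-cong f (λ l → sym (eval-⊗ (λ m → h (union l m)) g k)) ⟩
    eval (λ l → eval (λ m → h (union l m)) (g ⊗ k)) f                         ≡⟨ sym (eval-⊗ h f (g ⊗ k)) ⟩
    eval h (f ⊗ (g ⊗ k))                                                      ∎
    where open ≡-Reasoning

  ⊗-distribˡ : ∀ f g k → f ⊗ (g ⊕ k) ≃ f ⊗ g ⊕ f ⊗ k
  ⊗-distribˡ f g k = mk≃ λ h s → begin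
    eval h (f ⊗ (g ⊕ k))                                     ≡⟨ eval-⊗ h f (g ⊕ k) ⟩
    eval (λ l → eval (λ ν → h (union l ν)) (g ⊕ k)) f        ≡⟨ eval-cong f (λ l → eval-⊕ _ g k) ⟩
    eval (λ l → eval (λ ν → h (union l ν)) g + eval (λ ν → h (union l ν)) k) f
      ≡⟨ trans (∑-cong f (λ t → ℚP.*-distribˡ-+ (proj₁ t) _ _)) (∑-+ f _ _) ⟩
    eval (λ l → eval (λ ν → h (union l ν)) g) f + eval (λ l → eval (λ ν → h (union l ν)) k) f
      ≡⟨ cong₂ _+_ (sym (eval-⊗ h f g)) (sym (eval-⊗ h f k)) ⟩
    eval h (f ⊗ g) + eval h (f ⊗ k)                          ≡⟨ sym (eval-⊕ h (f ⊗ g) (f ⊗ k)) ⟩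
    eval h (f ⊗ g ⊕ f ⊗ k)                                   ∎
    where open ≡-Reasoning

  ⊗-distribʳ : ∀ f g k → (g ⊕ k) ⊗ f ≃ g ⊗ f ⊕ k ⊗ f
  ⊗-distribʳ f g k =
    ≃-trans (⊗-comm (g ⊕ k) f) (≃-trans (⊗-distribˡ f g k) (⊕-cong (⊗-comm f g) (⊗-comm f k)))

  ⊗-identityˡ : ∀ f → oneS ⊗ f ≃ f
  ⊗-identityˡ f = mk≃ λ h s → trans (eval-⊗ h oneS f) (trans (ℚP.+-identityʳ _) (ℚP.*-identityˡ _))

  p-∷ : ∀ x l → p (x ∷ l) ≃ p (x ∷ []) ⊗ p l
  p-∷ x l = mk≃ λ h s → sym (begin
    eval h (p (x ∷ []) ⊗ p l)                                     ≡⟨ eval-⊗ h (p (x ∷ [])) (p l) ⟩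
    eval (λ l' → eval (λ ν → h (union l' ν)) (p l)) (p (x ∷ []))  ≡⟨ eval-p (λ l' → eval (λ ν → h (union l' ν)) (p l)) (x ∷ []) ⟩
    eval (λ ν → h (union (sortP (x ∷ [])) ν)) (p l)               ≡⟨ eval-p (λ ν → h (union (sortP (x ∷ [])) ν)) l ⟩
    h (union (sortP (x ∷ [])) (sortP l))                          ≡⟨ cong h (sortP-∷ x) ⟩
    h (sortP (x ∷ l))                                             ≡⟨ sym (eval-p h (x ∷ l)) ⟩
    eval h (p (x ∷ l))                                            ∎)
    where
    open ≡-Reasoning
    sortP-∷ : ∀ x → union (sortP (x ∷ [])) (sortP l) ≡ sortP (x ∷ l)
    sortP-∷ ℕ.zero = refl
    sortP-∷ (ℕ.suc x) = refl

module Splittings where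

  open import Data.Nat as ℕ using (ℕ; zero; suc; _∸_)
  import Data.Nat.Properties as ℕP
  open import Data.Rational as ℚ using (ℚ; 1ℚ; _+_; _*_)
  open import Data.List using ([]; _∷_; _++_; map; length; replicate)
  open import Data.List.Properties using (map-++)
  open import Relation.Binary.PropositionalEquality
  open import Defs
  open Evaluation

  splitSum : ∀ {A : Set} → (A → A → A) → Partition → (Partition → Partition → A) → A
  splitSum _∙_ [] F = F [] []
  splitSum _∙_ (x ∷ μ) F = splitSum _∙_ μ (λ l n → F (x ∷ l) n) ∙ splitSum _∙_ μ (λ l n → F l (x ∷ n))

  eval-splitSum : ∀ h μ Φ → eval h (splitSum _⊕_ μ Φ) ≡ splitSum _+_ μ (λ l n → eval h (Φ l n))
  eval-splitSum h [] Φ = refl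
  eval-splitSum h (x ∷ μ) Φ =
    trans (eval-⊕ h (splitSum _⊕_ μ (λ l n → Φ (x ∷ l) n)) (splitSum _⊕_ μ (λ l n → Φ l (x ∷ n))))
          (cong₂ _+_ (eval-splitSum h μ (λ l n → Φ (x ∷ l) n)) (eval-splitSum h μ (λ l n → Φ l (x ∷ n))))

  splitSum-cong : ∀ {A : Set} (_∙_ : A → A → A) μ {F G : Partition → Partition → A} →
    (∀ l n → F l n ≡ G l n) → splitSum _∙_ μ F ≡ splitSum _∙_ μ G
  splitSum-cong _∙_ [] F≗G = F≗G [] []
  splitSum-cong _∙_ (x ∷ μ) F≗G =
    cong₂ _∙_ (splitSum-cong _∙_ μ (λ l n → F≗G (x ∷ l) n)) (splitSum-cong _∙_ μ (λ l n → F≗G l (x ∷ n)))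

  splitSum-≃ : ∀ μ {Φ Ψ} → (∀ l n → length l ℕ.+ length n ≡ length μ → Φ l n ≃ Ψ l n) →
    splitSum _⊕_ μ Φ ≃ splitSum _⊕_ μ Ψ
  splitSum-≃ [] Φ≃Ψ = Φ≃Ψ [] [] refl
  splitSum-≃ (x ∷ μ) Φ≃Ψ = ⊕-cong
    (splitSum-≃ μ (λ l n e → Φ≃Ψ (x ∷ l) n (cong suc e)))
    (splitSum-≃ μ (λ l n e → Φ≃Ψ l (x ∷ n) (trans (ℕP.+-suc (length l) (length n)) (cong suc e))))

  splitSum-⊗ˡ : ∀ μ c Φ → splitSum _⊕_ μ (λ l n → c ⊗ Φ l n) ≃ c ⊗ splitSum _⊕_ μ Φ
  splitSum-⊗ˡ [] c Φ = ≃-refl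
  splitSum-⊗ˡ (x ∷ μ) c Φ = ≃-trans
    (⊕-cong (splitSum-⊗ˡ μ c (λ l n → Φ (x ∷ l) n)) (splitSum-⊗ˡ μ c (λ l n → Φ l (x ∷ n))))
    (≃-sym (⊗-distribˡ c (splitSum _⊕_ μ (λ l n → Φ (x ∷ l) n)) (splitSum _⊕_ μ (λ l n → Φ l (x ∷ n)))))

  p₁ : ℕ → Sym
  p₁ i = p (i ∷ [])

  X : ℕ → ℕ → Sym
  X a i = p₁ (i ℕ.+ a) ⊖ p₁ i ⊗ p₁ a

  X-⊕ : ∀ a x → X a x ⊕ p₁ a ⊗ p₁ x ≃ p₁ (x ℕ.+ a)
  X-⊕ a x = mk≃ λ h s → begin
    eval h (X a x ⊕ p₁ a ⊗ p₁ x)                          ≡⟨ eval-⊕ h (X a x) (p₁ a ⊗ p₁ x) ⟩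
    eval h (X a x) + eval h (p₁ a ⊗ p₁ x)                 ≡⟨ cong (_+ eval h (p₁ a ⊗ p₁ x)) (eval-⊖ h) ⟩
    eval h (p₁ (x ℕ.+ a)) + -1ℚ * eval h (p₁ x ⊗ p₁ a) + eval h (p₁ a ⊗ p₁ x)
      ≡⟨ cong (eval h (p₁ (x ℕ.+ a)) + -1ℚ * eval h (p₁ x ⊗ p₁ a) +_) (eval-≡ (⊗-comm (p₁ a) (p₁ x)) h s) ⟩
    eval h (p₁ (x ℕ.+ a)) + -1ℚ * eval h (p₁ x ⊗ p₁ a) + eval h (p₁ x ⊗ p₁ a) ≡⟨ cancel _ _ ⟩
    eval h (p₁ (x ℕ.+ a))                                 ∎
    where
    open ≡-Reasoning
    open Sums using (ℚ-ring)
    open import Tactic.RingSolver using (solve-∀)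
    -1ℚ : ℚ
    -1ℚ = ℚ.- 1ℚ
    eval-⊖ : ∀ h → eval h (X a x) ≡ eval h (p₁ (x ℕ.+ a)) + -1ℚ * eval h (p₁ x ⊗ p₁ a)
    eval-⊖ h = trans (eval-⊕ h (p₁ (x ℕ.+ a)) (-1ℚ ⊙ (p₁ x ⊗ p₁ a)))
                     (cong (eval h (p₁ (x ℕ.+ a)) +_) (eval-⊙ h -1ℚ (p₁ x ⊗ p₁ a)))
    cancel : ∀ u v → u + -1ℚ * v + v ≡ u
    cancel = solve-∀ ℚ-ring

  expansionTerm : ℕ → ℕ → Partition → Partition → Sym
  expansionTerm a j l n = (powS (p₁ a) (j ℕ.+ length n) ⊗ prodS (map (X a) l)) ⊗ p n

  private
    expansionTerm-left : ∀ a j x l n → expansionTerm a j (x ∷ l) n ≃ X a x ⊗ expansionTerm a j l n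
    expansionTerm-left a j x l n = begin
      (P ⊗ (X a x ⊗ Q)) ⊗ p n  ≈⟨ ⊗-congˡ (p n) (≃-sym (⊗-assoc P (X a x) Q)) ⟩
      ((P ⊗ X a x) ⊗ Q) ⊗ p n  ≈⟨ ⊗-congˡ (p n) (⊗-congˡ Q (⊗-comm P (X a x))) ⟩
      ((X a x ⊗ P) ⊗ Q) ⊗ p n  ≈⟨ ⊗-congˡ (p n) (⊗-assoc (X a x) P Q) ⟩
      (X a x ⊗ (P ⊗ Q)) ⊗ p n  ≈⟨ ⊗-assoc (X a x) (P ⊗ Q) (p n) ⟩
      X a x ⊗ ((P ⊗ Q) ⊗ p n)  ∎
      where
      open ≃-Reasoning
      P = powS (p₁ a) (j ℕ.+ length n)
      Q = prodS (map (X a) l)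

    expansionTerm-right : ∀ a j x l n → expansionTerm a j l (x ∷ n) ≃ (p₁ a ⊗ p₁ x) ⊗ expansionTerm a j l n
    expansionTerm-right a j x l n = begin
      (powS (p₁ a) (j ℕ.+ suc (length n)) ⊗ Q) ⊗ p (x ∷ n)
        ≈⟨ ⊗-cong (⊗-congˡ Q (≃-reflexive (cong (powS (p₁ a)) (ℕP.+-suc j (length n))))) (p-∷ x n) ⟩
      ((p₁ a ⊗ P) ⊗ Q) ⊗ (p₁ x ⊗ p n)    ≈⟨ ⊗-congˡ (p₁ x ⊗ p n) (⊗-assoc (p₁ a) P Q) ⟩
      (p₁ a ⊗ (P ⊗ Q)) ⊗ (p₁ x ⊗ p n)    ≈⟨ ⊗-assoc (p₁ a) (P ⊗ Q) (p₁ x ⊗ p n) ⟩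
      p₁ a ⊗ ((P ⊗ Q) ⊗ (p₁ x ⊗ p n))    ≈⟨ ⊗-congʳ (p₁ a) (≃-sym (⊗-assoc (P ⊗ Q) (p₁ x) (p n))) ⟩
      p₁ a ⊗ (((P ⊗ Q) ⊗ p₁ x) ⊗ p n)    ≈⟨ ⊗-congʳ (p₁ a) (⊗-congˡ (p n) (⊗-comm (P ⊗ Q) (p₁ x))) ⟩
      p₁ a ⊗ ((p₁ x ⊗ (P ⊗ Q)) ⊗ p n)    ≈⟨ ⊗-congʳ (p₁ a) (⊗-assoc (p₁ x) (P ⊗ Q) (p n)) ⟩
      p₁ a ⊗ (p₁ x ⊗ ((P ⊗ Q) ⊗ p n))    ≈⟨ ≃-sym (⊗-assoc (p₁ a) (p₁ x) ((P ⊗ Q) ⊗ p n)) ⟩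
      (p₁ a ⊗ p₁ x) ⊗ ((P ⊗ Q) ⊗ p n)    ∎
      where
      open ≃-Reasoning
      P = powS (p₁ a) (j ℕ.+ length n)
      Q = prodS (map (X a) l)

  splitSum-expansionTerm : ∀ a μ j → splitSum _⊕_ μ (expansionTerm a j) ≃ powS (p₁ a) j ⊗ prodS (map (λ i → p₁ (i ℕ.+ a)) μ)
  splitSum-expansionTerm a [] j = begin
    (powS (p₁ a) (j ℕ.+ 0) ⊗ oneS) ⊗ oneS  ≈⟨ ⊗-comm (powS (p₁ a) (j ℕ.+ 0) ⊗ oneS) oneS ⟩
    oneS ⊗ (powS (p₁ a) (j ℕ.+ 0) ⊗ oneS)  ≈⟨ ⊗-identityˡ (powS (p₁ a) (j ℕ.+ 0) ⊗ oneS) ⟩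
    powS (p₁ a) (j ℕ.+ 0) ⊗ oneS           ≈⟨ ≃-reflexive (cong (λ m → powS (p₁ a) m ⊗ oneS) (ℕP.+-identityʳ j)) ⟩
    powS (p₁ a) j ⊗ oneS                   ∎
    where open ≃-Reasoning
  splitSum-expansionTerm a (x ∷ μ) j = begin
    splitSum _⊕_ μ (λ l n → T (x ∷ l) n) ⊕ splitSum _⊕_ μ (λ l n → T l (x ∷ n))
      ≈⟨ ⊕-cong (splitSum-≃ μ (λ l n _ → expansionTerm-left a j x l n))
                (splitSum-≃ μ (λ l n _ → expansionTerm-right a j x l n)) ⟩
    splitSum _⊕_ μ (λ l n → X a x ⊗ T l n) ⊕ splitSum _⊕_ μ (λ l n → Y ⊗ T l n)
      ≈⟨ ⊕-cong (splitSum-⊗ˡ μ (X a x) T) (splitSum-⊗ˡ μ Y T) ⟩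
    X a x ⊗ splitSum _⊕_ μ T ⊕ Y ⊗ splitSum _⊕_ μ T
      ≈⟨ ⊕-cong (⊗-congʳ (X a x) IH) (⊗-congʳ Y IH) ⟩
    X a x ⊗ (Pw ⊗ Pr) ⊕ Y ⊗ (Pw ⊗ Pr)   ≈⟨ ≃-sym (⊗-distribʳ (Pw ⊗ Pr) (X a x) Y) ⟩
    (X a x ⊕ Y) ⊗ (Pw ⊗ Pr)             ≈⟨ ⊗-congˡ (Pw ⊗ Pr) (X-⊕ a x) ⟩
    p₁ (x ℕ.+ a) ⊗ (Pw ⊗ Pr)            ≈⟨ ≃-sym (⊗-assoc (p₁ (x ℕ.+ a)) Pw Pr) ⟩
    (p₁ (x ℕ.+ a) ⊗ Pw) ⊗ Pr            ≈⟨ ⊗-congˡ Pr (⊗-comm (p₁ (x ℕ.+ a)) Pw) ⟩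
    (Pw ⊗ p₁ (x ℕ.+ a)) ⊗ Pr            ≈⟨ ⊗-assoc Pw (p₁ (x ℕ.+ a)) Pr ⟩
    Pw ⊗ (p₁ (x ℕ.+ a) ⊗ Pr)            ∎
    where
    open ≃-Reasoning
    T = expansionTerm a j
    Y = p₁ a ⊗ p₁ x
    Pw = powS (p₁ a) j
    Pr = prodS (map (λ i → p₁ (i ℕ.+ a)) μ)
    IH = splitSum-expansionTerm a μ j

  p-++ : ∀ L L' → p (L ++ L') ≃ p L ⊗ p L'
  p-++ [] L' = ≃-sym (⊗-identityˡ (p L'))
  p-++ (x ∷ L) L' = begin
    p (x ∷ L ++ L')          ≈⟨ p-∷ x (L ++ L') ⟩
    p₁ x ⊗ p (L ++ L')       ≈⟨ ⊗-congʳ (p₁ x) (p-++ L L') ⟩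
    p₁ x ⊗ (p L ⊗ p L')      ≈⟨ ≃-sym (⊗-assoc (p₁ x) (p L) (p L')) ⟩
    (p₁ x ⊗ p L) ⊗ p L'      ≈⟨ ⊗-congˡ (p L') (≃-sym (p-∷ x L)) ⟩
    p (x ∷ L) ⊗ p L'         ∎
    where open ≃-Reasoning

  p-map-+ : ∀ a μ → p (map (ℕ._+ a) μ) ≃ prodS (map (λ i → p₁ (i ℕ.+ a)) μ)
  p-map-+ a [] = ≃-refl
  p-map-+ a (x ∷ μ) = ≃-trans (p-∷ (x ℕ.+ a) (map (ℕ._+ a) μ)) (⊗-congʳ (p₁ (x ℕ.+ a)) (p-map-+ a μ))

  p-replicate : ∀ a j → p (map (ℕ._+ a) (replicate j 0)) ≃ powS (p₁ a) j
  p-replicate a zero = ≃-refl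
  p-replicate a (suc j) = ≃-trans (p-∷ a (map (ℕ._+ a) (replicate j 0))) (⊗-congʳ (p₁ a) (p-replicate a j))

  p-plusRect : ∀ a k μ → powS (p₁ a) (k ∸ length μ) ⊗ prodS (map (λ i → p₁ (i ℕ.+ a)) μ) ≃ p (plusRect a k μ)
  p-plusRect a k μ = ≃-sym (begin
    p (map (ℕ._+ a) (μ ++ zeros))                        ≈⟨ ≃-reflexive (cong p (map-++ (ℕ._+ a) μ zeros)) ⟩
    p (map (ℕ._+ a) μ ++ map (ℕ._+ a) zeros)             ≈⟨ p-++ (map (ℕ._+ a) μ) (map (ℕ._+ a) zeros) ⟩
    p (map (ℕ._+ a) μ) ⊗ p (map (ℕ._+ a) zeros)          ≈⟨ ⊗-cong (p-map-+ a μ) (p-replicate a (k ∸ length μ)) ⟩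
    prodS (map (λ i → p₁ (i ℕ.+ a)) μ) ⊗ powS (p₁ a) (k ∸ length μ)
                                                         ≈⟨ ⊗-comm (prodS (map (λ i → p₁ (i ℕ.+ a)) μ)) (powS (p₁ a) (k ∸ length μ)) ⟩
    powS (p₁ a) (k ∸ length μ) ⊗ prodS (map (λ i → p₁ (i ℕ.+ a)) μ) ∎)
    where
    open ≃-Reasoning
    zeros = replicate (k ∸ length μ) 0

module Convolution where

  open import Data.Nat as ℕ using (ℕ; zero; suc; _≤_; _<_; _≟_; z≤n; s≤s)
  import Data.Nat.Properties as ℕP
  open import Data.Rational using (ℚ; 0ℚ; 1ℚ; _+_; _*_)
  import Data.Rational.Properties as ℚP
  open import Data.Nat.ListAction using (sum)
  open import Data.Nat.ListAction.Properties using (sum-↭; sum-++)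
  open import Data.List using (List; []; _∷_; map; length)
  open import Data.List.Relation.Unary.All as All using (All; []; _∷_)
  import Data.List.Relation.Unary.All.Properties as Allᴾ
  open import Data.List.Relation.Unary.Linked as Linked using (linked?; [])
  import Data.List.Relation.Binary.Permutation.Propositional.Properties as ↭ᴾ
  open import Data.Product using (_×_; _,_; proj₁; proj₂)
  open import Relation.Nullary using (yes; no; Dec; ¬_)
  open import Relation.Nullary.Decidable using (_×-dec_)
  open import Data.Sum using (inj₁; inj₂)
  open import Relation.Binary.PropositionalEquality
  open import Data.Empty using (⊥-elim)
  open import Tactic.RingSolver using (solve-∀)
  open import Defs using (Partition; z; mult; union; insert; recip; IsPartition; partitionsUpTo)
  open Sums
  open NatCast
  open Reindexing
  open SortedLists
  open CentralizerOrder using (z-∷)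
  open PartitionEnumeration
  open Splittings using (splitSum)

  weightℕ : ℕ → ℕ → ℕ → ℚ
  weightℕ m l n = fromℕ m * recip l * recip n

  private
    cancel : ∀ m n c → fromℕ (m ℕ.* suc c) * recip (n ℕ.* suc c) ≡ fromℕ m * recip n
    cancel m n c = begin
      fromℕ (m ℕ.* suc c) * recip (n ℕ.* suc c)                   ≡⟨ cong₂ _*_ (fromℕ-* m (suc c)) (recip-* n (suc c)) ⟩
      (fromℕ m * fromℕ (suc c)) * (recip n * recip (suc c))       ≡⟨ rearrange (fromℕ m) (fromℕ (suc c)) (recip n) (recip (suc c)) ⟩
      fromℕ m * recip n * (recip (suc c) * fromℕ (suc c))         ≡⟨ cong (fromℕ m * recip n *_) (recip-inverseˡ c) ⟩
      fromℕ m * recip n * 1ℚ                                      ≡⟨ ℚP.*-identityʳ _ ⟩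
      fromℕ m * recip n                                           ∎
      where
      open ≡-Reasoning
      rearrange : ∀ a b c d → (a * b) * (c * d) ≡ a * c * (d * b)
      rearrange = solve-∀ ℚ-ring

  weightℕ-cancelˡ : ∀ m l n c → weightℕ (m ℕ.* suc c) (l ℕ.* suc c) n ≡ weightℕ m l n
  weightℕ-cancelˡ m l n c = cong (_* recip n) (cancel m l c)

  weightℕ-cancelʳ : ∀ m l n c → weightℕ (m ℕ.* suc c) l (n ℕ.* suc c) ≡ weightℕ m l n
  weightℕ-cancelʳ m l n c = begin
    fromℕ (m ℕ.* suc c) * recip l * recip (n ℕ.* suc c)  ≡⟨ swap23 (fromℕ (m ℕ.* suc c)) (recip l) (recip (n ℕ.* suc c)) ⟩
    fromℕ (m ℕ.* suc c) * recip (n ℕ.* suc c) * recip l  ≡⟨ cong (_* recip l) (cancel m n c) ⟩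
    fromℕ m * recip n * recip l                          ≡⟨ swap23 (fromℕ m) (recip n) (recip l) ⟩
    fromℕ m * recip l * recip n                          ∎
    where
    open ≡-Reasoning
    swap23 : ∀ a b c → a * b * c ≡ a * c * b
    swap23 = solve-∀ ℚ-ring

  weightℕ-+ : ∀ m c d l n → weightℕ (m ℕ.* (c ℕ.+ d)) l n ≡ weightℕ (m ℕ.* c) l n + weightℕ (m ℕ.* d) l n
  weightℕ-+ m c d l n = begin
    fromℕ (m ℕ.* (c ℕ.+ d)) * recip l * recip n
      ≡⟨ cong (λ q → fromℕ q * recip l * recip n) (ℕP.*-distribˡ-+ m c d) ⟩
    fromℕ (m ℕ.* c ℕ.+ m ℕ.* d) * recip l * recip n
      ≡⟨ cong (λ q → q * recip l * recip n) (fromℕ-+ (m ℕ.* c) (m ℕ.* d)) ⟩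
    (fromℕ (m ℕ.* c) + fromℕ (m ℕ.* d)) * recip l * recip n
      ≡⟨ distrib (fromℕ (m ℕ.* c)) (fromℕ (m ℕ.* d)) (recip l) (recip n) ⟩
    fromℕ (m ℕ.* c) * recip l * recip n + fromℕ (m ℕ.* d) * recip l * recip n ∎
    where
    open ≡-Reasoning
    distrib : ∀ a b c d → (a + b) * c * d ≡ a * c * d + b * c * d
    distrib = solve-∀ ℚ-ring

  -- When μ = l ∪ ν this is ∏ᵢ binom(nᵢ(μ), nᵢ(l)), the number of ways to split μ by positions into l and ν.
  weight : Partition → Partition → Partition → ℚ
  weight μ l ν = weightℕ (z μ) (z l) (z ν)

  splitTerm : Partition → (Partition → Partition → ℚ) → Partition → Partition → ℚ
  splitTerm μ F l ν = when (μ ≟ᴾ union l ν) (weight μ l ν * F l ν)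

  when-≡ : ∀ {u v : Partition} {q} → u ≡ v → when (u ≟ᴾ v) q ≡ q
  when-≡ {u} {v} u≡v with u ≟ᴾ v
  ... | yes _ = refl
  ... | no u≢v = ⊥-elim (u≢v u≡v)

  when-≢ : ∀ {u v : Partition} {q} → ¬ u ≡ v → when (u ≟ᴾ v) q ≡ 0ℚ
  when-≢ {u} {v} u≢v with u ≟ᴾ v
  ... | yes u≡v = ⊥-elim (u≢v u≡v)
  ... | no _ = refl

  onHead : ℕ → Partition → (Partition → ℚ) → ℚ
  onHead x [] g = 0ℚ
  onHead x (y ∷ l) g = when (y ≟ x) (g l)

  data HeadView (x : ℕ) : Partition → Set where
    headed : ∀ l → HeadView x (x ∷ l)
    unheaded : ∀ {l} → (∀ l' → ¬ l ≡ x ∷ l') → HeadView x l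

  headView : ∀ x l → HeadView x l
  headView x [] = unheaded (λ _ ())
  headView x (y ∷ l) with y ≟ x
  ... | yes refl = headed l
  ... | no y≢x = unheaded (λ l' e → y≢x (∷-injectiveˡ e))
    where
    ∷-injectiveˡ : ∀ {a b : ℕ} {u v : List ℕ} → a ∷ u ≡ b ∷ v → a ≡ b
    ∷-injectiveˡ refl = refl

  onHead-headed : ∀ x l g → onHead x (x ∷ l) g ≡ g l
  onHead-headed x l g with x ≟ x
  ... | yes _ = refl
  ... | no x≢x = ⊥-elim (x≢x refl)

  onHead-unheaded : ∀ x {l} g → (∀ l' → ¬ l ≡ x ∷ l') → onHead x l g ≡ 0ℚ
  onHead-unheaded x {[]} g h = refl
  onHead-unheaded x {y ∷ l} g h with y ≟ x
  ... | yes refl = ⊥-elim (h l refl)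
  ... | no _ = refl

  mult-union : ∀ x {μ} l ν → μ ≡ union l ν → mult x μ ≡ mult x l ℕ.+ mult x ν
  mult-union x l ν refl = trans (mult-↭ x (union-↭ l ν)) (mult-++ x l ν)

  union-bounded : ∀ {x μ'} l ν → Descending (x ∷ μ') → x ∷ μ' ≡ union l ν → All (_≤ x) l × All (_≤ x) ν
  union-bounded {x} l ν desc e =
    Allᴾ.++⁻ l (↭ᴾ.All-resp-↭ (union-↭ l ν) (subst (All (_≤ x)) e (ℕP.≤-refl ∷ descending-bound desc)))

  mult-unheaded : ∀ {x} ν → Descending ν → All (_≤ x) ν → (∀ l' → ¬ ν ≡ x ∷ l') → mult x ν ≡ 0
  mult-unheaded [] _ _ _ = refl
  mult-unheaded {x} (y ∷ ν) desc (y≤x ∷ _) not-headed =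
    mult-absent (y ∷ ν) (All.map (λ q e → ℕP.<-irrefl (sym e) (ℕP.≤-trans (s≤s q) y<x)) (ℕP.≤-refl ∷ descending-bound desc))
    where
    y<x : y < x
    y<x = ℕP.≤∧≢⇒< y≤x (λ e → not-headed ν (cong (_∷ ν) e))

  private
    z-∷-mult : ∀ x l {m} → 0 < x → suc (mult x l) ≡ m → z (x ∷ l) ≡ z l ℕ.* (x ℕ.* m)
    z-∷-mult x l 0<x refl = z-∷ x l 0<x

  module _ (x₀ : ℕ) where
    private
      x = suc x₀
      0<x : 0 < x
      0<x = s≤s z≤n

    -- Pascal's rule: with A, B the multiplicities of x in the two parts, (A + B)/(A B) = 1/B + 1/A.
    weight-both : ∀ μ' l' ν' → suc (mult x μ') ≡ suc (mult x l') ℕ.+ suc (mult x ν') →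
      weight (x ∷ μ') (x ∷ l') (x ∷ ν') ≡ weight μ' l' (x ∷ ν') + weight μ' (x ∷ l') ν'
    weight-both μ' l' ν' mults = begin
      weight (x ∷ μ') (x ∷ l') (x ∷ ν')
        ≡⟨ cong₃ weightℕ (trans (z-∷-mult x μ' 0<x mults) (cong (z μ' ℕ.*_) (ℕP.*-distribˡ-+ x A B)))
                         (z-∷ x l' 0<x) (z-∷ x ν' 0<x) ⟩
      weightℕ (z μ' ℕ.* (x ℕ.* A ℕ.+ x ℕ.* B)) (z l' ℕ.* (x ℕ.* A)) (z ν' ℕ.* (x ℕ.* B))
        ≡⟨ weightℕ-+ (z μ') (x ℕ.* A) (x ℕ.* B) (z l' ℕ.* (x ℕ.* A)) (z ν' ℕ.* (x ℕ.* B)) ⟩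
      weightℕ (z μ' ℕ.* (x ℕ.* A)) (z l' ℕ.* (x ℕ.* A)) (z ν' ℕ.* (x ℕ.* B))
        + weightℕ (z μ' ℕ.* (x ℕ.* B)) (z l' ℕ.* (x ℕ.* A)) (z ν' ℕ.* (x ℕ.* B))
        ≡⟨ cong₂ _+_ (weightℕ-cancelˡ (z μ') (z l') (z ν' ℕ.* (x ℕ.* B)) _) (weightℕ-cancelʳ (z μ') (z l' ℕ.* (x ℕ.* A)) (z ν') _) ⟩
      weightℕ (z μ') (z l') (z ν' ℕ.* (x ℕ.* B)) + weightℕ (z μ') (z l' ℕ.* (x ℕ.* A)) (z ν')
        ≡⟨ sym (cong₂ _+_ (cong (weightℕ (z μ') (z l')) (z-∷ x ν' 0<x))
                          (cong (λ q → weightℕ (z μ') q (z ν')) (z-∷ x l' 0<x))) ⟩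
      weight μ' l' (x ∷ ν') + weight μ' (x ∷ l') ν' ∎
      where
      open ≡-Reasoning
      A = suc (mult x l')
      B = suc (mult x ν')
      cong₃ : ∀ (f : ℕ → ℕ → ℕ → ℚ) {a a' b b' c c'} → a ≡ a' → b ≡ b' → c ≡ c' → f a b c ≡ f a' b' c'
      cong₃ f refl refl refl = refl

    weight-left : ∀ μ' l' ν → mult x μ' ≡ mult x l' → weight (x ∷ μ') (x ∷ l') ν ≡ weight μ' l' ν
    weight-left μ' l' ν mults = begin
      weight (x ∷ μ') (x ∷ l') ν
        ≡⟨ cong₂ (λ m l → weightℕ m l (z ν)) (z-∷-mult x μ' 0<x (cong suc mults)) (z-∷ x l' 0<x) ⟩
      weightℕ (z μ' ℕ.* (x ℕ.* suc (mult x l'))) (z l' ℕ.* (x ℕ.* suc (mult x l'))) (z ν)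
        ≡⟨ weightℕ-cancelˡ (z μ') (z l') (z ν) _ ⟩
      weight μ' l' ν ∎
      where open ≡-Reasoning

    weight-right : ∀ μ' l ν' → mult x μ' ≡ mult x ν' → weight (x ∷ μ') l (x ∷ ν') ≡ weight μ' l ν'
    weight-right μ' l ν' mults = begin
      weight (x ∷ μ') l (x ∷ ν')
        ≡⟨ cong₂ (λ m n → weightℕ m (z l) n) (z-∷-mult x μ' 0<x (cong suc mults)) (z-∷ x ν' 0<x) ⟩
      weightℕ (z μ' ℕ.* (x ℕ.* suc (mult x ν'))) (z l) (z ν' ℕ.* (x ℕ.* suc (mult x ν')))
        ≡⟨ weightℕ-cancelʳ (z μ') (z l) (z ν') _ ⟩
      weight μ' l ν' ∎
      where open ≡-Reasoning

  shiftˡ shiftʳ : ℕ → (Partition → Partition → ℚ) → Partition → Partition → ℚ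
  shiftˡ x F l n = F (x ∷ l) n
  shiftʳ x F l n = F l (x ∷ n)

  -- The largest part x of μ = x ∷ μ' ends up either in l or in ν.
  pascalRHS : ℕ → Partition → (Partition → Partition → ℚ) → Partition → Partition → ℚ
  pascalRHS x μ' F l ν = onHead x l (λ l' → splitTerm μ' (shiftˡ x F) l' ν)
                       + onHead x ν (λ ν' → splitTerm μ' (shiftʳ x F) l ν')

  module _ {x₀ : ℕ} {μ' : Partition} (F : Partition → Partition → ℚ) (desc : Descending (suc x₀ ∷ μ')) where
    private
      x = suc x₀

      mults-union : ∀ l ν → x ∷ μ' ≡ union l ν → suc (mult x μ') ≡ mult x l ℕ.+ mult x ν
      mults-union l ν D = trans (sym (mult-head x μ')) (mult-union x l ν D)

      split-left : ∀ l' ν → x ∷ μ' ≡ union (x ∷ l') ν → μ' ≡ union l' ν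
      split-left l' ν D = sym (insert-injective-tail x (union l' ν) μ' (sym D))

      split-right : ∀ l ν' → Descending (x ∷ ν') → x ∷ μ' ≡ union l (x ∷ ν') → μ' ≡ union l ν'
      split-right l ν' dν D = sym (insert-injective-tail x (union l ν') μ' (sym (trans D (union-cons-right l x ν' dν))))

    pascal-≢ : ∀ {l ν} → Descending ν → ¬ x ∷ μ' ≡ union l ν → HeadView x l → HeadView x ν → pascalRHS x μ' F l ν ≡ 0ℚ
    pascal-≢ {l} {ν} dν ¬D vl vν = trans (cong₂ _+_ (left vl) (right vν)) (ℚP.+-identityʳ 0ℚ)
      where
      left : HeadView x l → onHead x l (λ l' → splitTerm μ' (shiftˡ x F) l' ν) ≡ 0ℚ
      left (headed l') = trans (onHead-headed x l' (λ l'' → splitTerm μ' (shiftˡ x F) l'' ν))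
        (when-≢ {μ'} {union l' ν} (λ e → ¬D (sym (trans (cong (insert x) (sym e)) (insert-head x μ' desc)))))
      left (unheaded h) = onHead-unheaded x (λ l'' → splitTerm μ' (shiftˡ x F) l'' ν) h
      right : HeadView x ν → onHead x ν (λ ν' → splitTerm μ' (shiftʳ x F) l ν') ≡ 0ℚ
      right (headed ν') = trans (onHead-headed x ν' (λ ν'' → splitTerm μ' (shiftʳ x F) l ν''))
        (when-≢ {μ'} {union l ν'} (λ e → ¬D (sym (trans (union-cons-right l x ν' dν) (trans (cong (insert x) (sym e)) (insert-head x μ' desc))))))
      right (unheaded h) = onHead-unheaded x (λ ν'' → splitTerm μ' (shiftʳ x F) l ν'') h

    pascal-both : ∀ l' ν' → Descending (x ∷ ν') → x ∷ μ' ≡ union (x ∷ l') (x ∷ ν') →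
      splitTerm (x ∷ μ') F (x ∷ l') (x ∷ ν') ≡ pascalRHS x μ' F (x ∷ l') (x ∷ ν')
    pascal-both l' ν' dν D = begin
      splitTerm (x ∷ μ') F (x ∷ l') (x ∷ ν')                    ≡⟨ when-≡ D ⟩
      weight (x ∷ μ') (x ∷ l') (x ∷ ν') * Fv                    ≡⟨ cong (_* Fv) (weight-both x₀ μ' l' ν' mults) ⟩
      (weight μ' l' (x ∷ ν') + weight μ' (x ∷ l') ν') * Fv      ≡⟨ ℚP.*-distribʳ-+ Fv (weight μ' l' (x ∷ ν')) (weight μ' (x ∷ l') ν') ⟩
      weight μ' l' (x ∷ ν') * Fv + weight μ' (x ∷ l') ν' * Fv
        ≡⟨ sym (cong₂ _+_ (trans (onHead-headed x l' (λ l'' → splitTerm μ' (shiftˡ x F) l'' (x ∷ ν')))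
                                 (when-≡ (split-left l' (x ∷ ν') D)))
                          (trans (onHead-headed x ν' (λ ν'' → splitTerm μ' (shiftʳ x F) (x ∷ l') ν''))
                                 (when-≡ (split-right (x ∷ l') ν' dν D)))) ⟩
      pascalRHS x μ' F (x ∷ l') (x ∷ ν')                        ∎
      where
      open ≡-Reasoning
      Fv = F (x ∷ l') (x ∷ ν')
      mults : suc (mult x μ') ≡ suc (mult x l') ℕ.+ suc (mult x ν')
      mults = trans (mults-union (x ∷ l') (x ∷ ν') D) (cong₂ ℕ._+_ (mult-head x l') (mult-head x ν'))

    pascal-left : ∀ l' {ν} → Descending ν → (∀ ν' → ¬ ν ≡ x ∷ ν') → x ∷ μ' ≡ union (x ∷ l') ν →
      splitTerm (x ∷ μ') F (x ∷ l') ν ≡ pascalRHS x μ' F (x ∷ l') ν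
    pascal-left l' {ν} dν ν-unheaded D = begin
      splitTerm (x ∷ μ') F (x ∷ l') ν             ≡⟨ when-≡ D ⟩
      weight (x ∷ μ') (x ∷ l') ν * Fv             ≡⟨ cong (_* Fv) (weight-left x₀ μ' l' ν mults) ⟩
      weight μ' l' ν * Fv                         ≡⟨ sym (ℚP.+-identityʳ _) ⟩
      weight μ' l' ν * Fv + 0ℚ
        ≡⟨ sym (cong₂ _+_ (trans (onHead-headed x l' (λ l'' → splitTerm μ' (shiftˡ x F) l'' ν))
                                 (when-≡ (split-left l' ν D)))
                          (onHead-unheaded x (λ ν'' → splitTerm μ' (shiftʳ x F) (x ∷ l') ν'') ν-unheaded)) ⟩
      pascalRHS x μ' F (x ∷ l') ν                 ∎
      where
      open ≡-Reasoning
      Fv = F (x ∷ l') ν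
      mult-ν : mult x ν ≡ 0
      mult-ν = mult-unheaded ν dν (proj₂ (union-bounded (x ∷ l') ν desc D)) ν-unheaded
      mults : mult x μ' ≡ mult x l'
      mults = ℕP.suc-injective (trans (mults-union (x ∷ l') ν D) (trans (cong₂ ℕ._+_ (mult-head x l') mult-ν) (ℕP.+-identityʳ _)))

    pascal-right : ∀ {l} ν' → Descending l → Descending (x ∷ ν') → (∀ l' → ¬ l ≡ x ∷ l') → x ∷ μ' ≡ union l (x ∷ ν') →
      splitTerm (x ∷ μ') F l (x ∷ ν') ≡ pascalRHS x μ' F l (x ∷ ν')
    pascal-right {l} ν' dl dν l-unheaded D = begin
      splitTerm (x ∷ μ') F l (x ∷ ν')             ≡⟨ when-≡ D ⟩
      weight (x ∷ μ') l (x ∷ ν') * Fv             ≡⟨ cong (_* Fv) (weight-right x₀ μ' l ν' mults) ⟩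
      weight μ' l ν' * Fv                         ≡⟨ sym (ℚP.+-identityˡ _) ⟩
      0ℚ + weight μ' l ν' * Fv
        ≡⟨ sym (cong₂ _+_ (onHead-unheaded x (λ l'' → splitTerm μ' (shiftˡ x F) l'' (x ∷ ν')) l-unheaded)
                          (trans (onHead-headed x ν' (λ ν'' → splitTerm μ' (shiftʳ x F) l ν''))
                                 (when-≡ (split-right l ν' dν D)))) ⟩
      pascalRHS x μ' F l (x ∷ ν')                 ∎
      where
      open ≡-Reasoning
      Fv = F l (x ∷ ν')
      mult-l : mult x l ≡ 0
      mult-l = mult-unheaded l dl (proj₁ (union-bounded l (x ∷ ν') desc D)) l-unheaded
      mults : mult x μ' ≡ mult x ν'
      mults = ℕP.suc-injective (trans (mults-union l (x ∷ ν') D) (cong₂ ℕ._+_ mult-l (mult-head x ν')))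

    pascal-neither : ∀ {l ν} → Descending l → Descending ν → (∀ l' → ¬ l ≡ x ∷ l') → (∀ ν' → ¬ ν ≡ x ∷ ν') →
      ¬ x ∷ μ' ≡ union l ν
    pascal-neither {l} {ν} dl dν l-unheaded ν-unheaded D = ℕP.1+n≢0 (trans (mults-union l ν D) (cong₂ ℕ._+_ mult-l mult-ν))
      where
      mult-l = mult-unheaded l dl (proj₁ (union-bounded l ν desc D)) l-unheaded
      mult-ν = mult-unheaded ν dν (proj₂ (union-bounded l ν desc D)) ν-unheaded

  splitTerm-∷ : ∀ x μ' l ν F → IsPartition (x ∷ μ') → IsPartition l → IsPartition ν →
    splitTerm (x ∷ μ') F l ν ≡ pascalRHS x μ' F l ν
  splitTerm-∷ zero μ' l ν F ((() ∷ _) , _) _ _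
  splitTerm-∷ (suc x₀) μ' l ν F ((s≤s z≤n ∷ _) , desc) (_ , dl) (_ , dν) =
    by-cases (headView (suc x₀) l) (headView (suc x₀) ν) ((suc x₀ ∷ μ') ≟ᴾ union l ν)
    where
    x = suc x₀
    by-cases : HeadView x l → HeadView x ν → Dec (x ∷ μ' ≡ union l ν) → splitTerm (x ∷ μ') F l ν ≡ pascalRHS x μ' F l ν
    by-cases vl vν (no ¬D) = trans (when-≢ ¬D) (sym (pascal-≢ F desc dν ¬D vl vν))
    by-cases (headed l') (headed ν') (yes D) = pascal-both F desc l' ν' dν D
    by-cases (headed l') (unheaded hν) (yes D) = pascal-left F desc l' dν hν D
    by-cases (unheaded hl) (headed ν') (yes D) = pascal-right F desc ν' dl dν hl D
    by-cases (unheaded hl) (unheaded hν) (yes D) = ⊥-elim (pascal-neither F desc dl dν hl hν D)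

  private
    𝒫 : ℕ → List Partition
    𝒫 = partitionsUpTo

    partitionUpTo? : ∀ M v → Dec (PartitionUpTo M v)
    partitionUpTo? M v = (All.all? (0 ℕ.<?_) v ×-dec linked? (λ a b → b ℕ.≤? a) v) ×-dec (sum v ℕ.≤? M)

    partitionUpTo-tail : ∀ {M x w} → PartitionUpTo M (x ∷ w) → PartitionUpTo M w
    partitionUpTo-tail {M} {x} {w} (((_ ∷ pos) , desc) , sum≤M) =
      (pos , Linked.tail desc) , ℕP.≤-trans (ℕP.m≤n+m (sum w) x) sum≤M

  ∑-onHead : ∀ x M (ψ : Partition → ℚ) → (∀ w → PartitionUpTo M w → ¬ PartitionUpTo M (x ∷ w) → ψ w ≡ 0ℚ) →
    ∑ (𝒫 M) (λ l → onHead x l ψ) ≡ ∑ (𝒫 M) ψ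
  ∑-onHead x M ψ vanishes = begin
    ∑ (𝒫 M) g                          ≡⟨ ∑-reindex (𝒫 M) (map (x ∷_) (𝒫 M)) g (All.map once (partitionsUpTo-sound M))
                                                                            (Allᴾ.map⁺ (All.map once' (partitionsUpTo-sound M))) ⟩
    ∑ (map (x ∷_) (𝒫 M)) g             ≡⟨ ∑-map (x ∷_) (𝒫 M) g ⟩
    ∑ (𝒫 M) (λ w → onHead x (x ∷ w) ψ) ≡⟨ ∑-cong (𝒫 M) (λ w → onHead-headed x w ψ) ⟩
    ∑ (𝒫 M) ψ                          ∎
    where
    open ≡-Reasoning
    g = λ l → onHead x l ψ
    once : ∀ {w} → PartitionUpTo M w → OccursOnceIn g (map (x ∷_) (𝒫 M)) w
    once {w} pw with headView x w
    ... | headed w' = inj₂ (trans (count-map-∷ x w' (𝒫 M)) (count-partitionsUpTo M w' (partitionUpTo-tail pw)))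
    ... | unheaded h = inj₁ (onHead-unheaded x ψ h)
    once' : ∀ {w} → PartitionUpTo M w → OccursOnceIn g (𝒫 M) (x ∷ w)
    once' {w} pw with partitionUpTo? M (x ∷ w)
    ... | yes pxw = inj₂ (count-partitionsUpTo M (x ∷ w) pxw)
    ... | no ¬pxw = inj₁ (trans (onHead-headed x w ψ) (vanishes w pw ¬pxw))

  ∑-partitionsUpTo-[] : ∀ M (g : Partition → ℚ) → (∀ y w → g (y ∷ w) ≡ 0ℚ) → ∑ (𝒫 M) g ≡ g []
  ∑-partitionsUpTo-[] M g vanishes =
    trans (∑-reindex (𝒫 M) ([] ∷ []) g (All.map once (partitionsUpTo-sound M))
                     (inj₂ (count-partitionsUpTo M [] (([] , []) , z≤n)) ∷ []))
          (ℚP.+-identityʳ (g []))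
    where
    once : ∀ {w} → PartitionUpTo M w → OccursOnceIn g ([] ∷ []) w
    once {[]} _ = inj₂ (trans (cong (_+ 0ℚ) (δ-refl [])) (ℚP.+-identityʳ 1ℚ))
    once {y ∷ w} _ = inj₁ (vanishes y w)

  ∑-onHead-comm : ∀ x l (G : Partition → Partition → ℚ) (L : List Partition) →
    ∑ L (λ ν → onHead x l (λ l' → G l' ν)) ≡ onHead x l (λ l' → ∑ L (G l'))
  ∑-onHead-comm x [] G L = ∑-zero L
  ∑-onHead-comm x (y ∷ l') G L = ∑-when (y ≟ x) L (G l')

  private
    sum-union : ∀ l ν → sum (union l ν) ≡ sum l ℕ.+ sum ν
    sum-union l ν = trans (sum-↭ (union-↭ l ν)) (sum-++ l ν)

    partitionUpTo-∷ : ∀ {M x μ' w} → IsPartition (x ∷ μ') → sum (x ∷ μ') ≤ M → PartitionUpTo M w →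
      All (_≤ x) w → sum w ≤ sum μ' → PartitionUpTo M (x ∷ w)
    partitionUpTo-∷ {x = x} ((0<x ∷ _) , _) sum≤M ((pos , desc) , _) bound sum≤ =
      ((0<x ∷ pos) , descending-cons bound desc) , ℕP.≤-trans (ℕP.+-monoʳ-≤ x sum≤) sum≤M

  partitionUpTo-∷-left : ∀ {M x μ' w} ν → IsPartition (x ∷ μ') → sum (x ∷ μ') ≤ M → PartitionUpTo M w →
    μ' ≡ union w ν → PartitionUpTo M (x ∷ w)
  partitionUpTo-∷-left {x = x} {w = w} ν pμ sum≤M pw e = partitionUpTo-∷ pμ sum≤M pw
    (Allᴾ.++⁻ˡ w (↭ᴾ.All-resp-↭ (union-↭ w ν) (subst (All (_≤ x)) e (descending-bound (proj₂ pμ)))))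
    (subst (sum w ≤_) (sym (trans (cong sum e) (sum-union w ν))) (ℕP.m≤m+n (sum w) (sum ν)))

  partitionUpTo-∷-right : ∀ {M x μ' w} l → IsPartition (x ∷ μ') → sum (x ∷ μ') ≤ M → PartitionUpTo M w →
    μ' ≡ union l w → PartitionUpTo M (x ∷ w)
  partitionUpTo-∷-right {x = x} {w = w} l pμ sum≤M pw e = partitionUpTo-∷ pμ sum≤M pw
    (Allᴾ.++⁻ʳ l (↭ᴾ.All-resp-↭ (union-↭ l w) (subst (All (_≤ x)) e (descending-bound (proj₂ pμ)))))
    (subst (sum w ≤_) (sym (trans (cong sum e) (sum-union l w))) (ℕP.m≤n+m (sum w) (sum l)))

  convolution : ℕ → Partition → (Partition → Partition → ℚ) → ℚ
  convolution M μ F = ∑ (𝒫 M) (λ l → ∑ (𝒫 M) (λ ν → splitTerm μ F l ν))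

  private
    []≢insert : ∀ x L → ¬ [] ≡ insert x L
    []≢insert x L e = ℕP.0≢1+n (subst (λ m → length m ≡ suc (length L)) (sym e) (↭ᴾ.↭-length (insert-↭ x L)))

  convolution-[] : ∀ M F → convolution M [] F ≡ F [] []
  convolution-[] M F = begin
    ∑ (𝒫 M) (λ l → ∑ (𝒫 M) (λ ν → splitTerm [] F l ν))
      ≡⟨ ∑-partitionsUpTo-[] M (λ l → ∑ (𝒫 M) (splitTerm [] F l))
           (λ y w → ∑-zeroᴬ (splitTerm [] F (y ∷ w)) (All.universal (λ ν → when-≢ ([]≢insert y (union w ν))) (𝒫 M))) ⟩
    ∑ (𝒫 M) (λ ν → splitTerm [] F [] ν)
      ≡⟨ ∑-partitionsUpTo-[] M (splitTerm [] F []) (λ y w → when-≢ {[]} {y ∷ w} {weight [] [] (y ∷ w) * F [] (y ∷ w)} (λ ())) ⟩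
    splitTerm [] F [] []                  ≡⟨ when-≡ {[]} refl ⟩
    weight [] [] [] * F [] []             ≡⟨ ℚP.*-identityˡ (F [] []) ⟩
    F [] []                               ∎
    where open ≡-Reasoning

  convolution-∷ : ∀ x μ' M → IsPartition (x ∷ μ') → sum (x ∷ μ') ≤ M → (F : Partition → Partition → ℚ) →
    convolution M (x ∷ μ') F ≡ convolution M μ' (shiftˡ x F) + convolution M μ' (shiftʳ x F)
  convolution-∷ x μ' M pμ sum≤M F = begin
    ∑ (𝒫 M) (λ l → ∑ (𝒫 M) (λ ν → splitTerm (x ∷ μ') F l ν))
      ≡⟨ ∑-congᴬ (All.map (λ pl → ∑-congᴬ (All.map (λ pν → splitTerm-∷ x μ' _ _ F pμ (proj₁ pl) (proj₁ pν))
                                                    (partitionsUpTo-sound M)))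
                          (partitionsUpTo-sound M)) ⟩
    ∑ (𝒫 M) (λ l → ∑ (𝒫 M) (λ ν → A l ν + B l ν))
      ≡⟨ ∑-cong (𝒫 M) (λ l → ∑-+ (𝒫 M) (A l) (B l)) ⟩
    ∑ (𝒫 M) (λ l → ∑ (𝒫 M) (A l) + ∑ (𝒫 M) (B l))
      ≡⟨ ∑-+ (𝒫 M) (λ l → ∑ (𝒫 M) (A l)) (λ l → ∑ (𝒫 M) (B l)) ⟩
    ∑ (𝒫 M) (λ l → ∑ (𝒫 M) (A l)) + ∑ (𝒫 M) (λ l → ∑ (𝒫 M) (B l))
      ≡⟨ cong₂ _+_ left-part right-part ⟩
    convolution M μ' (shiftˡ x F) + convolution M μ' (shiftʳ x F) ∎
    where
    open ≡-Reasoning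
    G H : Partition → Partition → ℚ
    G l' ν = splitTerm μ' (shiftˡ x F) l' ν
    H l ν' = splitTerm μ' (shiftʳ x F) l ν'
    A B : Partition → Partition → ℚ
    A l ν = onHead x l (λ l' → G l' ν)
    B l ν = onHead x ν (H l)
    left-part : ∑ (𝒫 M) (λ l → ∑ (𝒫 M) (A l)) ≡ convolution M μ' (shiftˡ x F)
    left-part = begin
      ∑ (𝒫 M) (λ l → ∑ (𝒫 M) (A l))                         ≡⟨ ∑-cong (𝒫 M) (λ l → ∑-onHead-comm x l G (𝒫 M)) ⟩
      ∑ (𝒫 M) (λ l → onHead x l (λ l' → ∑ (𝒫 M) (G l')))
        ≡⟨ ∑-onHead x M (λ l' → ∑ (𝒫 M) (G l')) (λ w pw ¬pxw → ∑-zeroᴬ (G w)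
             (All.map (λ {ν} _ → when-≢ (λ e → ¬pxw (partitionUpTo-∷-left ν pμ sum≤M pw e))) (partitionsUpTo-sound M))) ⟩
      convolution M μ' (shiftˡ x F)                         ∎
    right-part : ∑ (𝒫 M) (λ l → ∑ (𝒫 M) (B l)) ≡ convolution M μ' (shiftʳ x F)
    right-part = ∑-congᴬ (All.map (λ {l} _ → ∑-onHead x M (H l) (λ w pw ¬pxw →
                   when-≢ (λ e → ¬pxw (partitionUpTo-∷-right l pμ sum≤M pw e)))) (partitionsUpTo-sound M))

  convolution-splitSum : ∀ μ M → IsPartition μ → sum μ ≤ M → (F : Partition → Partition → ℚ) →
    convolution M μ F ≡ splitSum _+_ μ F
  convolution-splitSum [] M _ _ F = convolution-[] M F
  convolution-splitSum (x ∷ μ') M pμ sum≤M F =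
    trans (convolution-∷ x μ' M pμ sum≤M F)
          (cong₂ _+_ (convolution-splitSum μ' M pμ' sum≤M' (shiftˡ x F)) (convolution-splitSum μ' M pμ' sum≤M' (shiftʳ x F)))
    where
    pμ' : IsPartition μ'
    pμ' = All.tail (proj₁ pμ) , Linked.tail (proj₂ pμ)
    sum≤M' : sum μ' ≤ M
    sum≤M' = ℕP.≤-trans (ℕP.m≤n+m (sum μ') x) sum≤M

module PowerSumOperator where

  open import Data.Nat as ℕ using (ℕ; _≤_; _≤?_; _∸_)
  import Data.Nat.Properties as ℕP
  open import Data.Nat.ListAction using (sum)
  open import Data.Rational using (ℚ; 0ℚ; 1ℚ; _+_; _*_)
  import Data.Rational.Properties as ℚP
  open import Data.List using (map; length; filter)
  import Data.List.Relation.Unary.All as All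
  open import Data.Product using (_,_; proj₁; proj₂)
  open import Relation.Nullary using (yes; no; Dec)
  open import Relation.Binary.PropositionalEquality
  open import Function using (_∘_)
  open import Tactic.RingSolver using (solve-∀)
  open import Defs
  open Sums
  open NatCast using (fromℕ)
  open Reindexing using (_≟ᴾ_; δ)
  open SortedLists
  open PartitionEnumeration using (PartitionUpTo; partitionsUpTo-sound)
  open Evaluation
  open Splittings
  open Convolution

  cpTerm : ℕ → ℕ → Partition → Partition → Sym
  cpTerm a k l n = (powS (p₁ a) (k ∸ length l) ⊗ prodS (map (X a) l)) ⊗ p n

  -- The summand of CP, restated because it is bound in a where block; the two agree definitionally.
  cpSummand : ℕ → ℕ → Sym → Partition → Sym
  cpSummand a k P la = powS (p₁ a) (k ∸ length la) ⊗ prodS (map (X a) la) ⊗ (recip (z la) ⊙ perp (p la) P)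

  pairIP-1 : ∀ la ν → pairIP (1ℚ , la) (1ℚ , ν) ≡ when (la ≟ᴾ ν) (fromℕ (z la))
  pairIP-1 la ν with la ≟ᴾ ν
  ... | yes _ = ℚP.*-identityˡ (fromℕ (z la))
  ... | no _ = refl

  hall-p : ∀ {μ l ν} → IsPartition μ → IsPartition l → IsPartition ν →
    ⟪ p μ , p l ⊗ p ν ⟫ ≡ when (μ ≟ᴾ union l ν) (fromℕ (z μ))
  hall-p {μ} {l} {ν} pμ pl pν
    rewrite sortP-partition pμ | sortP-partition pl | sortP-partition pν =
    trans (ℚP.+-identityʳ _) (pairIP-1 μ (union l ν))

  private
    when-scale : ∀ {q} {Q : Set q} (d : Dec Q) v a b c → a * (when d v * b * c) ≡ when d (v * a * b * c)
    when-scale (yes _) v a b c = rearrange v a b c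
      where
      rearrange : ∀ v a b c → a * (v * b * c) ≡ v * a * b * c
      rearrange = solve-∀ ℚ-ring
    when-scale (no _) v a b c = annihilate a b c
      where
      annihilate : ∀ a b c → a * (0ℚ * b * c) ≡ 0ℚ
      annihilate = solve-∀ ℚ-ring

  module _ (a k : ℕ) {μ : Partition} (pμ : IsPartition μ) where
    private
      M = deg (p μ)
      𝒫M = partitionsUpTo M

    eval-cpSummand : ∀ h {l} → IsPartition l →
      eval h (cpSummand a k (p μ) l) ≡ ∑ 𝒫M (splitTerm μ (λ l' n → eval h (cpTerm a k l' n)) l)
    eval-cpSummand h {l} pl = begin
      eval h (W ⊗ (recip (z l) ⊙ perp (p l) (p μ)))                 ≡⟨ eval-⊗ʳ h W (recip (z l) ⊙ perp (p l) (p μ)) ⟩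
      eval Hf (recip (z l) ⊙ perp (p l) (p μ))                       ≡⟨ eval-⊙ Hf (recip (z l)) (perp (p l) (p μ)) ⟩
      recip (z l) * eval Hf (perp (p l) (p μ))                       ≡⟨ cong (recip (z l) *_) (∑-map (λ ν → (⟪ p μ , p l ⊗ p ν ⟫ * recip (z ν) , ν)) 𝒫M (λ t → proj₁ t * Hf (proj₂ t))) ⟩
      recip (z l) * ∑ 𝒫M (λ ν → ⟪ p μ , p l ⊗ p ν ⟫ * recip (z ν) * Hf ν)
        ≡⟨ sym (∑-*ˡ 𝒫M (recip (z l)) (λ ν → ⟪ p μ , p l ⊗ p ν ⟫ * recip (z ν) * Hf ν)) ⟩
      ∑ 𝒫M (λ ν → recip (z l) * (⟪ p μ , p l ⊗ p ν ⟫ * recip (z ν) * Hf ν))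
        ≡⟨ ∑-congᴬ (All.map pointwise (partitionsUpTo-sound M)) ⟩
      ∑ 𝒫M (splitTerm μ F l)                                         ∎
      where
      open ≡-Reasoning
      W = powS (p₁ a) (k ∸ length l) ⊗ prodS (map (X a) l)
      F = λ l' n → eval h (cpTerm a k l' n)
      Hf : Partition → ℚ
      Hf ν = eval (λ l' → h (union l' ν)) W
      Hf-cpTerm : ∀ {ν} → IsPartition ν → Hf ν ≡ F l ν
      Hf-cpTerm {ν} pν = sym (trans (eval-⊗ʳ h W (p ν)) (trans (eval-p Hf ν) (cong Hf (sortP-partition pν))))
      pointwise : ∀ {ν} → PartitionUpTo M ν →
        recip (z l) * (⟪ p μ , p l ⊗ p ν ⟫ * recip (z ν) * Hf ν) ≡ splitTerm μ F l ν
      pointwise {ν} (pν , _) = begin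
        recip (z l) * (⟪ p μ , p l ⊗ p ν ⟫ * recip (z ν) * Hf ν)
          ≡⟨ cong (λ q → recip (z l) * (q * recip (z ν) * Hf ν)) (hall-p pμ pl pν) ⟩
        recip (z l) * (when (μ ≟ᴾ union l ν) (fromℕ (z μ)) * recip (z ν) * Hf ν)
          ≡⟨ when-scale (μ ≟ᴾ union l ν) (fromℕ (z μ)) (recip (z l)) (recip (z ν)) (Hf ν) ⟩
        when (μ ≟ᴾ union l ν) (weight μ l ν * Hf ν)
          ≡⟨ cong (λ q → when (μ ≟ᴾ union l ν) (weight μ l ν * q)) (Hf-cpTerm pν) ⟩
        splitTerm μ F l ν ∎

    eval-CP : length μ ≤ k → ∀ h → eval h (CP a k (p μ)) ≡ splitSum _+_ μ (λ l n → eval h (cpTerm a k l n))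
    eval-CP μ≤k h = begin
      eval h (CP a k (p μ))                                             ≡⟨ eval-sumS h (map summand (filter fits? 𝒫M)) ⟩
      ∑ (map summand (filter fits? 𝒫M)) (eval h)                        ≡⟨ ∑-map summand (filter fits? 𝒫M) (eval h) ⟩
      ∑ (filter fits? 𝒫M) (λ l → eval h (summand l))                    ≡⟨ ∑-filter fits? 𝒫M (λ l → eval h (summand l)) ⟩
      ∑ 𝒫M (λ l → when (fits? l) (eval h (summand l)))                  ≡⟨ ∑-congᴬ (All.map restricted (partitionsUpTo-sound M)) ⟩
      convolution M μ F                                                 ≡⟨ convolution-splitSum μ M pμ sum≤M F ⟩
      splitSum _+_ μ F                                                  ∎
      where
      open ≡-Reasoning
      summand = cpSummand a k (p μ)
      fits? = λ (la : Partition) → length la ≤? k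
      F = λ l n → eval h (cpTerm a k l n)
      sum≤M : sum μ ≤ M
      sum≤M = subst (λ v → sum v ≤ M) (sortP-partition pμ) (ℕP.m≤m⊔n (sum (sortP μ)) 0)
      length-part : ∀ {l ν} → μ ≡ union l ν → length l ≤ k
      length-part {l} {ν} e = ℕP.≤-trans (ℕP.m≤m+n (length l) (length ν))
        (ℕP.≤-trans (ℕP.≤-reflexive (sym (trans (cong length e) (length-union l ν)))) μ≤k)
      restricted : ∀ {l} → PartitionUpTo M l → when (fits? l) (eval h (summand l)) ≡ ∑ 𝒫M (splitTerm μ F l)
      restricted {l} (pl , _) with fits? l
      ... | yes _ = eval-cpSummand h pl
      ... | no l≰k = sym (∑-zeroᴬ (splitTerm μ F l)
                           (All.universal (λ ν → when-≢ (λ e → l≰k (length-part {l} {ν} e))) 𝒫M))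

  -- Coefficients are values at the non-symmetric δ ν la, but all keys of f ⊗ p n are already sorted.
  eval-⊗-p-sort : ∀ h f n → eval h (f ⊗ p n) ≡ eval (λ ν → h (sort ν)) (f ⊗ p n)
  eval-⊗-p-sort h f n = begin
    eval h (f ⊗ p n)                                           ≡⟨ eval-⊗ʳ h f (p n) ⟩
    eval (λ ν → eval (λ l → h (union l ν)) f) (p n)            ≡⟨ eval-p (λ ν → eval (λ l → h (union l ν)) f) n ⟩
    eval (λ l → h (union l (sortP n))) f
      ≡⟨ eval-cong f (λ l → cong h (sym (sort-descending (union-descending l (sortP-descending n))))) ⟩
    eval (λ l → h (sort (union l (sortP n)))) f                ≡⟨ sym (eval-p (λ ν → eval (λ l → h (sort (union l ν))) f) n) ⟩
    eval (λ ν → eval (λ l → h (sort (union l ν))) f) (p n)     ≡⟨ sym (eval-⊗ʳ (λ ν → h (sort ν)) f (p n)) ⟩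
    eval (λ ν → h (sort ν)) (f ⊗ p n)                          ∎
    where open ≡-Reasoning

  eval-p-sort : ∀ h L → eval (λ ν → h (sort ν)) (p L) ≡ eval h (p L)
  eval-p-sort h L = trans (eval-p (λ ν → h (sort ν)) L)
                          (trans (cong h (sort-descending (sortP-descending L))) (sym (eval-p h L)))

  ∸≡∸+ : ∀ k m n → m ℕ.+ n ≤ k → k ∸ m ≡ (k ∸ (m ℕ.+ n)) ℕ.+ n
  ∸≡∸+ k m n m+n≤k = begin
    k ∸ m                          ≡⟨ sym (ℕP.m∸n+n≡m n≤k∸m) ⟩
    (k ∸ m ∸ n) ℕ.+ n              ≡⟨ cong (ℕ._+ n) (ℕP.∸-+-assoc k m n) ⟩
    (k ∸ (m ℕ.+ n)) ℕ.+ n          ∎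
    where
    open ≡-Reasoning
    n≤k∸m : n ≤ k ∸ m
    n≤k∸m = ℕP.m+n≤o⇒m≤o∸n n (subst (_≤ k) (ℕP.+-comm m n) m+n≤k)

  splitSum-cpTerm : ∀ a k μ → length μ ≤ k → splitSum _⊕_ μ (cpTerm a k) ≃ p (plusRect a k μ)
  splitSum-cpTerm a k μ μ≤k = begin
    splitSum _⊕_ μ (cpTerm a k)                                        ≈⟨ splitSum-≃ μ same-term ⟩
    splitSum _⊕_ μ (expansionTerm a (k ∸ length μ))                    ≈⟨ splitSum-expansionTerm a μ (k ∸ length μ) ⟩
    powS (p₁ a) (k ∸ length μ) ⊗ prodS (map (λ i → p₁ (i ℕ.+ a)) μ)   ≈⟨ p-plusRect a k μ ⟩
    p (plusRect a k μ)                                                 ∎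
    where
    open ≃-Reasoning
    exponent : ∀ l n → length l ℕ.+ length n ≡ length μ → k ∸ length l ≡ (k ∸ length μ) ℕ.+ length n
    exponent l n e = trans (∸≡∸+ k (length l) (length n) (subst (_≤ k) (sym e) μ≤k))
                           (cong (λ m → (k ∸ m) ℕ.+ length n) e)
    same-term : ∀ l n → length l ℕ.+ length n ≡ length μ → cpTerm a k l n ≃ expansionTerm a (k ∸ length μ) l n
    same-term l n e = ≃-reflexive (cong (λ m → (powS (p₁ a) m ⊗ prodS (map (X a) l)) ⊗ p n) (exponent l n e))

  CP-p : ∀ a k {μ} → IsPartition μ → length μ ≤ k → CP a k (p μ) ≈ p (plusRect a k μ)
  CP-p a k {μ} pμ μ≤k la = begin
    coeff (CP a k (p μ)) la                                   ≡⟨ coeff-eval (CP a k (p μ)) la ⟩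
    eval δla (CP a k (p μ))                                   ≡⟨ eval-CP a k pμ μ≤k δla ⟩
    splitSum _+_ μ (λ l n → eval δla (cpTerm a k l n))        ≡⟨ splitSum-cong _+_ μ (λ l n → eval-⊗-p-sort δla (W l) n) ⟩
    splitSum _+_ μ (λ l n → eval δla∘sort (cpTerm a k l n))   ≡⟨ sym (eval-splitSum δla∘sort μ (cpTerm a k)) ⟩
    eval δla∘sort (splitSum _⊕_ μ (cpTerm a k))               ≡⟨ eval-≡ (splitSum-cpTerm a k μ μ≤k) δla∘sort (cong δla ∘ sort-↭) ⟩
    eval δla∘sort (p (plusRect a k μ))                        ≡⟨ eval-p-sort δla (plusRect a k μ) ⟩
    eval δla (p (plusRect a k μ))                             ≡⟨ sym (coeff-eval (p (plusRect a k μ)) la) ⟩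
    coeff (p (plusRect a k μ)) la                             ∎
    where
    open ≡-Reasoning
    W = λ l → powS (p₁ a) (k ∸ length l) ⊗ prodS (map (X a) l)
    δla = λ ν → δ ν la
    δla∘sort = λ ν → δla (sort ν)

mainTheorem1 : (a : ℕ) → 0 < a → (k : ℕ) → (μ : Partition) → IsPartition μ →
    length μ < k → CP a k (p μ) ≈ p (plusRect a k μ)
mainTheorem1 a _ k μ pμ μ<k = PowerSumOperator.CP-p a k pμ (<⇒≤ μ<k)
  where open import Data.Nat.Properties using (<⇒≤)
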